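{- Let $n\ge1$ and let $P\in\mathcal{P}_n$ have no north steps (so $P$ consists of $2n$ steps, $n$ east and $n$ south). Then $M=\Phi(P)$, where $\Phi=\phi\circ\psi$, is the unique matching on $[2n]$ with no nestings such that, for each $i\in[2n]$, $i$ is a left endpoint of an edge of $M$ exactly when the $(2n+1-i)$-th step of $P$ is a south step.
   Context: $\mathcal{P}_n$: self-avoiding lattice paths from the origin with unit east, north, south steps, confined to the wedge $-x\le y\le x$, with $n$ east steps, ending at $(n,-n)$; such a path is determined by the $y$-coordinates $a_1,\dots,a_n$ of its east steps, $-(i-1)\le a_i\le i-1$. A matching on $[2n]$ is a partition into $n$ two-element edges $(a,b)$, $a<b$; $a$ is its left endpoint. Edges $(a,b),(c,d)$ with $a<c$ are crossed if $a<c<b<d$, nested if $a<c<d<b$, aligned otherwise. $\psi$: put $b_i=a_{n+1-i}+n+1-i$; for $i=1,\dots,n$ in order, connect the leftmost not-yet-connected vertex of $[2n]$ to the $b_i$-th not-yet-connected vertex to its right. $\phi$ (on matchings of $[2n]$) is defined recursively: for $n=1$ it is the identity. For $n>1$, let $e_1=(1,r)$, $e_2$ be the first two edges of $M$ (by left endpoints); delete $e_1$, renumber, apply $\phi$, then reinsert $e_1=(1,r)$ in its original position, obtaining $N_2$. If $e_1,e_2$ are aligned, $\phi(M)=N_2$. If crossed: let $2=l_2<\dots<l_k$ be the left endpoints of the edges $f_i=(l_i,r_i)$ of $N_2$ crossing $e_1$; replace them by edges $(l_3,r_2),\dots,(l_k,r_{k-1})$, insert a new vertex immediately before $r$ joined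 to $r_k$, delete vertex $2$ and renumber. If nested with $e_2=(2,q)$: let $f_1,\dots,f_p$ (resp. $f_{p+1},\dots,f_{p+s}$) be the edges $(l_i,r_i)$ of $N_2$ crossing both $e_1$ and $e_2$ (resp. crossing $e_1$ but not $e_2$), with $l_1<\dots<l_p<q<l_{p+1}<\dots<l_{p+s}$, and $\{v_1<\dots<v_{p+s+1}\}=\{l_1,\dots,l_{p+s},q\}$; remove $e_2,f_1,\dots,f_{p+s}$, insert a new vertex immediately before $r$ joined to $v_{s+1}$, join $r_1,\dots,r_{p+s}$ to $v_1,\dots,v_s,v_{s+2},\dots,v_{p+s+1}$ respectively, delete vertex $2$ and renumber. -}

module Defs where

open import Data.Nat using (ℕ; zero; suc; _+_; _*_; _∸_; _<ᵇ_; _≤ᵇ_; _≡ᵇ_; _<_)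
open import Data.Bool using (Bool; true; false; if_then_else_; not; _∧_)
open import Data.List using (List; []; _∷_; _++_; map; foldr; length; filterᵇ; reverse; replicate; concatMap; upTo; zip)
open import Data.List.Membership.Propositional using (_∈_)
open import Data.List.Relation.Binary.Permutation.Propositional using (_↭_)
open import Data.List.Relation.Unary.All using (All)
open import Data.Product using (_×_; _,_; proj₁; proj₂; ∃)
open import Data.Maybe using (Maybe; just; nothing)
open import Data.Fin using (Fin; toℕ)
open import Data.Vec using (Vec; toList; tabulate; lookup)
open import Data.Integer as ℤ using (ℤ; +_; ∣_∣)
open import Relation.Nullary using (¬_; does)
open import Relation.Binary.PropositionalEquality using (_≡_)

-- Lattice paths in 𝒫_n, encoded (as in the paper) by the y-coordinates
-- a_1,…,a_n of the east steps.  Index (i : Fin n) stands for a_{toℕ i + 1}.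

InP : (n : ℕ) → Vec ℤ n → Set
InP n a = ∀ (i : Fin n) → (ℤ.- (+ toℕ i)) ℤ.≤ lookup a i × lookup a i ℤ.≤ (+ toℕ i)

data Step : Set where
  E N S : Step

vert : ℤ → ℤ → List Step
vert y y' = if does (y' ℤ.≤? y) then replicate ∣ y ℤ.- y' ∣ S else replicate ∣ y' ℤ.- y ∣ N

-- east step at height a_i, then the vertical segment to a_{i+1}
-- (or to the final height -n after the last east step)
stepsFrom : List ℤ → ℤ → List Step
stepsFrom [] fin = []
stepsFrom (y ∷ []) fin = E ∷ vert y fin
stepsFrom (y ∷ y' ∷ ys) fin = (E ∷ vert y y') ++ stepsFrom (y' ∷ ys) fin

steps : (n : ℕ) → Vec ℤ n → List Step
steps n a = stepsFrom (toList a) (ℤ.- (+ n))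

-- k-th element, 1-based
nth : {A : Set} → List A → ℕ → Maybe A
nth [] k = nothing
nth (x ∷ xs) zero = nothing
nth (x ∷ xs) (suc zero) = just x
nth (x ∷ xs) (suc (suc k)) = nth xs (suc k)

NoNorth : List Step → Set
NoNorth w = ¬ (N ∈ w)

-- Matchings on [2n] = {1,…,2n} as lists of edges (a , b).

Edge : Set
Edge = ℕ × ℕ

endpoints : List Edge → List ℕ
endpoints = concatMap (λ e → proj₁ e ∷ proj₂ e ∷ [])

range1 : ℕ → List ℕ
range1 m = map suc (upTo m)

IsMatching : ℕ → List Edge → Set
IsMatching n M = All (λ e → proj₁ e < proj₂ e) M × (endpoints M ↭ range1 (2 * n))

Nested : Edge → Edge → Set
Nested (a , b) (c , d) = a < c × c < d × d < b

NoNestings : List Edge → Set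
NoNestings M = ∀ e f → e ∈ M → f ∈ M → ¬ Nested e f

IsLeftEndpoint : List Edge → ℕ → Set
IsLeftEndpoint M i = ∃ λ b → (i , b) ∈ M

SameMatching : List Edge → List Edge → Set
SameMatching M M' = ∀ a b → ((a , b) ∈ M → (a , b) ∈ M') × ((a , b) ∈ M' → (a , b) ∈ M)

pick : ℕ → List ℕ → ℕ × List ℕ
pick k [] = (0 , [])
pick zero (x ∷ xs) = (0 , x ∷ xs)
pick (suc zero) (x ∷ xs) = (x , xs)
pick (suc (suc k)) (x ∷ xs) = let r = pick (suc k) xs in (proj₁ r , x ∷ proj₂ r)

psiGo : List ℕ → List ℕ → List Edge
psiGo [] bs = []
psiGo (v ∷ rest) [] = []
psiGo (v ∷ rest) (b ∷ bs) = let r = pick b rest in (v , proj₁ r) ∷ psiGo (proj₂ r) bs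

-- b_i = a_{n+1-i} + n + 1 - i, for i = 1..n
bseq : (n : ℕ) → Vec ℤ n → List ℕ
bseq n a = reverse (toList (tabulate (λ (j : Fin n) → ∣ lookup a j ℤ.+ (+ suc (toℕ j)) ∣)))

ψ : (n : ℕ) → Vec ℤ n → List Edge
ψ n a = psiGo (range1 (2 * n)) (bseq n a)

insertBy : {A : Set} → (A → ℕ) → A → List A → List A
insertBy k x [] = x ∷ []
insertBy k x (y ∷ ys) = if k x ≤ᵇ k y then x ∷ y ∷ ys else y ∷ insertBy k x ys

sortBy : {A : Set} → (A → ℕ) → List A → List A
sortBy k = foldr (insertBy k) []

orient : Edge → Edge
orient (a , b) = if a <ᵇ b then (a , b) else (b , a)

mapEdge : (ℕ → ℕ) → Edge → Edge
mapEdge f (a , b) = (f a , f b)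

normalize : List Edge → List Edge
normalize M = map (λ e → orient (mapEdge rank e)) M
  where
  rank : ℕ → ℕ
  rank v = suc (length (filterᵇ (λ w → w <ᵇ v) (endpoints M)))

dbl : Edge → Edge
dbl = mapEdge (λ v → 2 * v)

-- deleting the edge (1 , r) and renumbering, and its inverse
ren : ℕ → ℕ → ℕ
ren r v = if v <ᵇ r then v ∸ 1 else v ∸ 2

unren : ℕ → ℕ → ℕ
unren r w = if (w + 1) <ᵇ r then w + 1 else w + 2

eqEdge : Edge → Edge → Bool
eqEdge (a , b) (c , d) = (a ≡ᵇ c) ∧ (b ≡ᵇ d)

crossesE1 : ℕ → Edge → Bool
crossesE1 r (l , r') = (1 <ᵇ l) ∧ (l <ᵇ r) ∧ (r <ᵇ r')

-- crossed case, doubled coordinates: (l_{j+1}, r_j) and (new vertex 2r-1, r_k)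
chain : ℕ → List Edge → List Edge
chain r [] = []
chain r ((l , r₁) ∷ []) = (2 * r ∸ 1 , 2 * r₁) ∷ []
chain r ((l , r₁) ∷ (l' , r₂) ∷ fs) = (2 * l' , 2 * r₁) ∷ chain r ((l' , r₂) ∷ fs)

-- 0-based element access and removal
at0 : List ℕ → ℕ → ℕ
at0 [] k = 0
at0 (x ∷ xs) zero = x
at0 (x ∷ xs) (suc k) = at0 xs k

removeAt0 : List ℕ → ℕ → List ℕ
removeAt0 [] k = []
removeAt0 (x ∷ xs) zero = xs
removeAt0 (x ∷ xs) (suc k) = x ∷ removeAt0 xs k

-- φ with fuel (the number of edges)
phiF : ℕ → List Edge → List Edge
phiF zero M = M
phiF (suc k) M = go (sortBy proj₁ (map orient M))
  where
  go : List Edge → List Edge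
  go [] = []
  go (e ∷ []) = e ∷ []
  go ((l₁ , r) ∷ (c , q) ∷ rest) =
    if r <ᵇ c then (l₁ , r) ∷ N2rest
    else (if r <ᵇ q then crossed else nested)
    where
    N2rest : List Edge
    N2rest = map (mapEdge (unren r)) (phiF k (map (mapEdge (ren r)) ((c , q) ∷ rest)))
    F : List Edge
    F = sortBy proj₁ (filterᵇ (crossesE1 r) N2rest)
    others : List Edge
    others = filterᵇ (λ e → not (crossesE1 r e)) N2rest
    crossed : List Edge
    crossed = normalize (dbl (l₁ , r) ∷ map dbl others ++ chain r F)
    others' : List Edge
    others' = filterᵇ (λ e → not (eqEdge e (c , q))) others
    Ls : List ℕ
    Ls = map proj₁ F
    Rs : List ℕ
    Rs = map proj₂ F
    s : ℕ
    s = length (filterᵇ (λ l → q <ᵇ l) Ls)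
    V : List ℕ
    V = sortBy (λ x → x) (q ∷ Ls)
    nested : List Edge
    nested = normalize (dbl (l₁ , r) ∷ map dbl others'
                        ++ (2 * r ∸ 1 , 2 * at0 V s)
                        ∷ map (λ p → (2 * proj₁ p , 2 * proj₂ p)) (zip (removeAt0 V s) Rs))

φ : List Edge → List Edge
φ M = phiF (length M) M

Φ : (n : ℕ) → Vec ℤ n → List Edge
Φ n a = φ (ψ n a)

module Submission where

-- A non-nesting matching listed by increasing left endpoints has increasing
-- right endpoints as well ("standard form"); a standard matching is determined
-- by its left endpoints, since its right endpoints are the complement.  This
-- gives uniqueness, and existence is shown for ψ(P) and transferred to Φ(P):
--   * for a north-free path ψ receives a valid b-sequence, on which it
--     produces a standard matching with explicit right endpoints (psi-standard);
--   * φ fixes standard matchings up to the order of the edges, because the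
--     first two edges are never nested and the crossed-case reconnection is an
--     order-preserving relabelling undone by normalize (phi-fixes-standard);
--   * read backwards, the step word has its east steps exactly at those right
--     endpoints (revWord-letter), so the left endpoints are the south steps.

open import Defs
open import Data.Bool using (Bool; true; false; T; not; if_then_else_)
open import Data.Bool.Properties using (∧-identityʳ)
open import Data.Empty using (⊥; ⊥-elim)
open import Data.Unit using (⊤; tt)
open import Data.Product using (_×_; _,_; proj₁; proj₂; ∃)
open import Data.Sum using (_⊎_; inj₁; inj₂)
open import Data.Maybe using (just)
open import Data.Nat using (ℕ; zero; suc; _+_; _*_; _∸_; _≤_; _<_; z≤n; s≤s; s≤s⁻¹; z<s; _<ᵇ_; _≤ᵇ_; _≡ᵇ_)
open import Data.Nat.Properties
import Data.Nat.Tactic.RingSolver as ℕ-Solver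
open import Data.Integer as ℤ using (ℤ; +_; ∣_∣; 1ℤ)
import Data.Integer.Properties as ℤ
open import Data.Integer.Tactic.RingSolver using (solve-∀)
open import Data.Fin using (Fin; toℕ)
import Data.Fin as Fin
open import Data.Vec as Vec using (Vec; toList; tabulate; lookup)
import Data.Vec.Properties as Vec
open import Data.List using (List; []; _∷_; _++_; map; length; applyUpTo; filterᵇ; reverse; replicate)
open import Data.List.Properties
  using (∷-injective; length-++; length-map; length-replicate; length-reverse; ++-assoc; ++-identityʳ;
         map-id-local; map-∘; map-++; map-cong-local; unfold-reverse; reverse-++; reverse-involutive)
open import Data.List.Membership.Propositional using (_∈_)
open import Data.List.Membership.Propositional.Properties
  using (∈-++⁻; ∈-++⁺ˡ; ∈-++⁺ʳ; ∈-map⁺; ∈-map⁻; ∈-filter⁺; ∈-filter⁻)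
open import Data.List.Relation.Unary.Any using (here; there)
open import Data.List.Relation.Unary.All as All using (All; []; _∷_)
import Data.List.Relation.Unary.All.Properties as All
open import Data.List.Relation.Unary.AllPairs as AllPairs using (AllPairs; []; _∷_)
import Data.List.Relation.Unary.AllPairs.Properties as AllPairs
open import Data.List.Relation.Unary.Unique.Propositional using (Unique)
open import Data.List.Relation.Binary.Permutation.Propositional
  using (_↭_; ↭-refl; ↭-reflexive; ↭-sym; ↭-trans; prep; swap)
open import Data.List.Relation.Binary.Permutation.Propositional.Properties
  using (All-resp-↭; ∈-resp-↭; ↭-length; ¬x∷xs↭[]; drop-∷; shift; shifts; map⁺; filter-↭; ++⁺ʳ; ++-comm)
open import Relation.Nullary using (¬_; yes; no)
open import Relation.Binary.Definitions using (tri<; tri≈; tri>)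
open import Relation.Binary.PropositionalEquality

T⇒≡true : ∀ {b} → T b → b ≡ true
T⇒≡true {true} _ = refl

≡true⇒T : ∀ {b} → b ≡ true → T b
≡true⇒T refl = tt

¬T⇒≡false : ∀ {b} → ¬ T b → b ≡ false
¬T⇒≡false {false} _ = refl
¬T⇒≡false {true} ¬t = ⊥-elim (¬t tt)

≡false⇒¬T : ∀ {b} → b ≡ false → ¬ T b
≡false⇒¬T refl ()

<ᵇ-true : ∀ {m n} → m < n → (m <ᵇ n) ≡ true
<ᵇ-true m<n = T⇒≡true (<⇒<ᵇ m<n)

<ᵇ-false : ∀ {m n} → ¬ m < n → (m <ᵇ n) ≡ false
<ᵇ-false {m} {n} m≮n = ¬T⇒≡false (λ t → m≮n (<ᵇ⇒< m n t))

<ᵇ-true⁻ : ∀ {m n} → (m <ᵇ n) ≡ true → m < n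
<ᵇ-true⁻ {m} {n} e = <ᵇ⇒< m n (≡true⇒T e)

<ᵇ-false⁻ : ∀ {m n} → (m <ᵇ n) ≡ false → ¬ m < n
<ᵇ-false⁻ e m<n = ≡false⇒¬T e (<⇒<ᵇ m<n)

≤ᵇ-true : ∀ {m n} → m ≤ n → (m ≤ᵇ n) ≡ true
≤ᵇ-true m≤n = T⇒≡true (≤⇒≤ᵇ m≤n)

≤ᵇ-false⁻ : ∀ {m n} → (m ≤ᵇ n) ≡ false → ¬ m ≤ n
≤ᵇ-false⁻ e m≤n = ≡false⇒¬T e (≤⇒≤ᵇ m≤n)

≤ᵇ-true⁻ : ∀ {m n} → (m ≤ᵇ n) ≡ true → m ≤ n
≤ᵇ-true⁻ {m} {n} e = ≤ᵇ⇒≤ m n (≡true⇒T e)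

≡ᵇ-true : ∀ {m n} → m ≡ n → (m ≡ᵇ n) ≡ true
≡ᵇ-true {m} {n} m≡n = T⇒≡true (≡⇒≡ᵇ m n m≡n)

≡ᵇ-false : ∀ {m n} → ¬ m ≡ n → (m ≡ᵇ n) ≡ false
≡ᵇ-false {m} {n} m≢n = ¬T⇒≡false (λ t → m≢n (≡ᵇ⇒≡ m n t))

interval : ℕ → ℕ → List ℕ
interval a zero = []
interval a (suc k) = a ∷ interval (suc a) k

∈-interval⁻ : ∀ {a k v} → v ∈ interval a k → a ≤ v × v < a + k
∈-interval⁻ {a} {suc k} (here refl) = ≤-refl , m<m+n a z<s
∈-interval⁻ {a} {suc k} {v} (there p) with ∈-interval⁻ {suc a} {k} p
... | a<v , v<a+1+k = <⇒≤ a<v , subst (v <_) (sym (+-suc a k)) v<a+1+k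

∈-interval⁺ : ∀ {a k v} → a ≤ v → v < a + k → v ∈ interval a k
∈-interval⁺ {a} {zero} {v} a≤v v<a+0 = ⊥-elim (<⇒≱ v<a+0 (subst (_≤ v) (sym (+-identityʳ a)) a≤v))
∈-interval⁺ {a} {suc k} {v} a≤v v<a+k with a ≟ v
... | yes refl = here refl
... | no a≢v = there (∈-interval⁺ (≤∧≢⇒< a≤v a≢v) (subst (v <_) (+-suc a k) v<a+k))

length-interval : ∀ a k → length (interval a k) ≡ k
length-interval a zero = refl
length-interval a (suc k) = cong suc (length-interval (suc a) k)

interval-++ : ∀ a t u → interval a (t + u) ≡ interval a t ++ interval (a + t) u
interval-++ a zero u rewrite +-identityʳ a = refl
interval-++ a (suc t) u rewrite interval-++ (suc a) t u | +-suc a t = refl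

range1≡interval : ∀ m → range1 m ≡ interval 1 m
range1≡interval m = go m (λ i → i) 1 (λ i → refl)
  where
  go : ∀ m (f : ℕ → ℕ) a → (∀ i → suc (f i) ≡ a + i) → map suc (applyUpTo f m) ≡ interval a m
  go zero f a h = refl
  go (suc m) f a h = cong₂ _∷_ (trans (h 0) (+-identityʳ a))
    (go m (λ i → f (suc i)) (suc a) (λ i → trans (h (suc i)) (+-suc a i)))

map-interval-shift : ∀ (f : ℕ → ℕ) a k c → (∀ w → a ≤ w → w < a + k → f w ≡ w + c) →
  map f (interval a k) ≡ interval (a + c) k
map-interval-shift f a zero c h = refl
map-interval-shift f a (suc k) c h = cong₂ _∷_ (h a ≤-refl (m<m+n a z<s))
  (map-interval-shift f (suc a) k c (λ w a<w w<a+k → h w (≤-trans (n≤1+n a) a<w) (subst (w <_) (sym (+-suc a k)) w<a+k)))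

-- Strictly increasing lists.  Two of them with the same elements are equal;
-- this is how uniqueness of matchings is eventually proved.

Increasing : List ℕ → Set
Increasing = AllPairs _<_

interval-increasing : ∀ a k → Increasing (interval a k)
interval-increasing a zero = []
interval-increasing a (suc k) =
  All.tabulate (λ v∈ → proj₁ (∈-interval⁻ {suc a} {k} v∈)) ∷ interval-increasing (suc a) k

increasing⇒unique : ∀ {xs} → Increasing xs → Unique xs
increasing⇒unique = AllPairs.map <⇒≢

increasing-head-≤ : ∀ {x xs v} → Increasing (x ∷ xs) → v ∈ x ∷ xs → x ≤ v
increasing-head-≤ _ (here refl) = ≤-refl
increasing-head-≤ (x< ∷ _) (there v∈) = <⇒≤ (All.lookup x< v∈)

increasing-extensional : ∀ xs ys → Increasing xs → Increasing ys →
  (∀ v → v ∈ xs → v ∈ ys) → (∀ v → v ∈ ys → v ∈ xs) → xs ≡ ys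
increasing-extensional [] [] _ _ _ _ = refl
increasing-extensional [] (y ∷ ys) _ _ _ ys⊆ with ys⊆ y (here refl)
... | ()
increasing-extensional (x ∷ xs) [] _ _ xs⊆ _ with xs⊆ x (here refl)
... | ()
increasing-extensional (x ∷ xs) (y ∷ ys) ixs@(x< ∷ ixs') iys@(y< ∷ iys') xs⊆ ys⊆ =
  cong₂ _∷_ x≡y (increasing-extensional xs ys ixs' iys'
    (λ v v∈ → tail-∈ x≡y (xs⊆ v (there v∈)) (All.lookup x< v∈))
    (λ v v∈ → tail-∈ (sym x≡y) (ys⊆ v (there v∈)) (All.lookup y< v∈)))
  where
  x≡y : x ≡ y
  x≡y = ≤-antisym (increasing-head-≤ ixs (ys⊆ y (here refl))) (increasing-head-≤ iys (xs⊆ x (here refl)))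
  tail-∈ : ∀ {x y v zs} → x ≡ y → v ∈ y ∷ zs → x < v → v ∈ zs
  tail-∈ x≡y (here refl) x<v = ⊥-elim (<-irrefl x≡y x<v)
  tail-∈ _ (there v∈) _ = v∈

unique-resp-↭ : ∀ {xs ys : List ℕ} → xs ↭ ys → Unique xs → Unique ys
unique-resp-↭ _↭_.refl u = u
unique-resp-↭ (prep x p) (x∉ ∷ u) = All-resp-↭ p x∉ ∷ unique-resp-↭ p u
unique-resp-↭ (swap x y p) ((x≢y ∷ x∉) ∷ (y∉ ∷ u)) =
  ((λ e → x≢y (sym e)) ∷ All-resp-↭ p y∉) ∷ (All-resp-↭ p x∉ ∷ unique-resp-↭ p u)
unique-resp-↭ (_↭_.trans p q) u = unique-resp-↭ q (unique-resp-↭ p u)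

module Sorting {A : Set} (key : A → ℕ) where

  Sorted StrictlySorted : List A → Set
  Sorted = AllPairs (λ x y → key x ≤ key y)
  StrictlySorted = AllPairs (λ x y → key x < key y)

  insertBy-↭ : ∀ x ys → insertBy key x ys ↭ x ∷ ys
  insertBy-↭ x [] = ↭-refl
  insertBy-↭ x (y ∷ ys) with key x ≤ᵇ key y
  ... | true = ↭-refl
  ... | false = ↭-trans (prep y (insertBy-↭ x ys)) (swap y x ↭-refl)

  sortBy-↭ : ∀ xs → sortBy key xs ↭ xs
  sortBy-↭ [] = ↭-refl
  sortBy-↭ (x ∷ xs) = ↭-trans (insertBy-↭ x (sortBy key xs)) (prep x (sortBy-↭ xs))

  insertBy-sorted : ∀ x ys → Sorted ys → Sorted (insertBy key x ys)
  insertBy-sorted x [] s = [] ∷ []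
  insertBy-sorted x (y ∷ ys) s@(y≤ ∷ sys) with key x ≤ᵇ key y in eq
  ... | true = (≤ᵇ-true⁻ eq ∷ All.map (≤-trans (≤ᵇ-true⁻ eq)) y≤) ∷ s
  ... | false = All-resp-↭ (↭-sym (insertBy-↭ x ys)) (<⇒≤ (≰⇒> (≤ᵇ-false⁻ eq)) ∷ y≤)
                ∷ insertBy-sorted x ys sys

  sortBy-sorted : ∀ xs → Sorted (sortBy key xs)
  sortBy-sorted [] = []
  sortBy-sorted (x ∷ xs) = insertBy-sorted x (sortBy key xs) (sortBy-sorted xs)

  sortBy-id : ∀ xs → StrictlySorted xs → sortBy key xs ≡ xs
  sortBy-id [] s = refl
  sortBy-id (x ∷ []) s = refl
  sortBy-id (x ∷ y ∷ ys) ((x<y ∷ _) ∷ s) rewrite sortBy-id (y ∷ ys) s | ≤ᵇ-true (<⇒≤ x<y) = refl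

  sorted-unique : ∀ xs ys → Sorted xs → StrictlySorted ys → xs ↭ ys → xs ≡ ys
  sorted-unique [] [] _ _ _ = refl
  sorted-unique [] (y ∷ ys) _ _ p = ⊥-elim (¬x∷xs↭[] (↭-sym p))
  sorted-unique (x ∷ xs) [] _ _ p = ⊥-elim (¬x∷xs↭[] p)
  sorted-unique (x ∷ xs) (y ∷ ys) (x≤ ∷ sxs) (y< ∷ sys) p
    with ∈-resp-↭ p (here refl) | ∈-resp-↭ (↭-sym p) (here refl)
  ... | here refl | _ = cong (x ∷_) (sorted-unique xs ys sxs sys (drop-∷ p))
  ... | there _ | here refl = cong (y ∷_) (sorted-unique xs ys sxs sys (drop-∷ p))
  ... | there x∈ | there y∈ = ⊥-elim (<⇒≱ (All.lookup y< x∈) (All.lookup x≤ y∈))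

lefts rights : List Edge → List ℕ
lefts = map proj₁
rights = map proj₂

Oriented : List Edge → Set
Oriented = All (λ e → proj₁ e < proj₂ e)

-- A matching in standard form: edges listed by increasing left endpoint,
-- whose right endpoints then increase as well.  These are exactly the
-- non-nesting matchings sorted by left endpoints.
Standard : List Edge → Set
Standard M = Increasing (lefts M) × Increasing (rights M) × Oriented M

StandardOn : ℕ → List Edge → Set
StandardOn K M = Standard M × endpoints M ↭ interval 1 K

endpoints-↭ : ∀ {M M'} → M ↭ M' → endpoints M ↭ endpoints M'
endpoints-↭ _↭_.refl = ↭-refl
endpoints-↭ (prep (a , b) p) = prep a (prep b (endpoints-↭ p))
endpoints-↭ (swap (a , b) (c , d) p) =
  ↭-trans (shifts (a ∷ b ∷ []) (c ∷ d ∷ [])) (prep c (prep d (prep a (prep b (endpoints-↭ p)))))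
endpoints-↭ (_↭_.trans p q) = ↭-trans (endpoints-↭ p) (endpoints-↭ q)

∈-endpointsˡ : ∀ {M a b} → (a , b) ∈ M → a ∈ endpoints M
∈-endpointsˡ (here refl) = here refl
∈-endpointsˡ (there p) = there (there (∈-endpointsˡ p))

∈-endpointsʳ : ∀ {M a b} → (a , b) ∈ M → b ∈ endpoints M
∈-endpointsʳ (here refl) = there (here refl)
∈-endpointsʳ (there p) = there (there (∈-endpointsʳ p))

∈-endpoints⁻ : ∀ {M v} → v ∈ endpoints M → (∃ λ b → (v , b) ∈ M) ⊎ (∃ λ a → (a , v) ∈ M)
∈-endpoints⁻ {(a , b) ∷ M} (here refl) = inj₁ (b , here refl)
∈-endpoints⁻ {(a , b) ∷ M} (there (here refl)) = inj₂ (a , here refl)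
∈-endpoints⁻ {(a , b) ∷ M} (there (there p)) with ∈-endpoints⁻ {M} p
... | inj₁ (b' , q) = inj₁ (b' , there q)
... | inj₂ (a' , q) = inj₂ (a' , there q)

endpoints-map : ∀ (f : ℕ → ℕ) M → endpoints (map (mapEdge f) M) ≡ map f (endpoints M)
endpoints-map f [] = refl
endpoints-map f ((a , b) ∷ M) = cong (λ z → f a ∷ f b ∷ z) (endpoints-map f M)

lefts-map : ∀ (f : ℕ → ℕ) M → lefts (map (mapEdge f) M) ≡ map f (lefts M)
lefts-map f [] = refl
lefts-map f ((a , b) ∷ M) = cong (f a ∷_) (lefts-map f M)

rights-map : ∀ (f : ℕ → ℕ) M → rights (map (mapEdge f) M) ≡ map f (rights M)
rights-map f [] = refl
rights-map f ((a , b) ∷ M) = cong (f b ∷_) (rights-map f M)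

∈-lefts⁺ : ∀ {M a b} → (a , b) ∈ M → a ∈ lefts M
∈-lefts⁺ = ∈-map⁺ proj₁

∈-rights⁺ : ∀ {M a b} → (a , b) ∈ M → b ∈ rights M
∈-rights⁺ = ∈-map⁺ proj₂

∈-lefts⁻ : ∀ {M v} → v ∈ lefts M → ∃ λ b → (v , b) ∈ M
∈-lefts⁻ {(a , b) ∷ M} (here refl) = b , here refl
∈-lefts⁻ {(a , b) ∷ M} (there p) with ∈-lefts⁻ {M} p
... | b' , q = b' , there q

∈-rights⁻ : ∀ {M v} → v ∈ rights M → ∃ λ a → (a , v) ∈ M
∈-rights⁻ {(a , b) ∷ M} (here refl) = a , here refl
∈-rights⁻ {(a , b) ∷ M} (there p) with ∈-rights⁻ {M} p
... | a' , q = a' , there q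

not-left-and-right : ∀ {M a b c} → Unique (endpoints M) → Oriented M → (a , b) ∈ M → (b , c) ∈ M → ⊥
not-left-and-right {(x , y) ∷ M} _ (x<y ∷ _) (here refl) (here refl) = <-irrefl refl (<-trans x<y x<y)
not-left-and-right {(x , y) ∷ M} (_ ∷ (y∉ ∷ _)) _ (here refl) (there q) = All.lookup y∉ (∈-endpointsˡ q) refl
not-left-and-right {(x , y) ∷ M} (x∉ ∷ _) _ (there p) (here refl) = All.lookup x∉ (there (∈-endpointsʳ p)) refl
not-left-and-right {(x , y) ∷ M} (_ ∷ (_ ∷ u)) (_ ∷ o) (there p) (there q) = not-left-and-right u o p q

standardOn-unique : ∀ {K M} → StandardOn K M → Unique (endpoints M)
standardOn-unique (_ , p) = unique-resp-↭ (↭-sym p) (increasing⇒unique (interval-increasing 1 _))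

-- A non-nesting matching sorted by left endpoints is in standard form:
-- if (a , b) precedes (c , d) then a < c, hence b < d (b = d is impossible
-- and d < b would be a nesting).
open Sorting (proj₁ {B = λ _ → ℕ})

sorted-nonnesting⇒standard : ∀ M → Sorted M → Unique (endpoints M) → Oriented M →
  (∀ e f → e ∈ M → f ∈ M → ¬ Nested e f) → Standard M
sorted-nonnesting⇒standard [] _ _ _ _ = [] , [] , []
sorted-nonnesting⇒standard ((a , b) ∷ M) (a≤ ∷ sM) (a∉ ∷ (b∉ ∷ u)) (a<b ∷ o) nn
  with sorted-nonnesting⇒standard M sM u o (λ e f p q → nn e f (there p) (there q))
... | il , ir , _ = (All.map⁺ (All.tabulate a<left) ∷ il) , (All.map⁺ (All.tabulate b<right) ∷ ir) , (a<b ∷ o)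
  where
  a<left : ∀ {f} → f ∈ M → a < proj₁ f
  a<left {(c , d)} p = ≤∧≢⇒< (All.lookup a≤ p) (All.lookup a∉ (there (∈-endpointsˡ p)))
  b<right : ∀ {f} → f ∈ M → b < proj₂ f
  b<right {(c , d)} p with <-cmp b d
  ... | tri< b<d _ _ = b<d
  ... | tri≈ _ b≡d _ = ⊥-elim (All.lookup b∉ (∈-endpointsʳ p) b≡d)
  ... | tri> _ _ d<b = ⊥-elim (nn (a , b) (c , d) (here refl) (there p) (a<left p , All.lookup o p , d<b))

sort-nonnesting : ∀ K M → Oriented M → endpoints M ↭ interval 1 K → NoNestings M →
  StandardOn K (sortBy proj₁ M)
sort-nonnesting K M o p nn =
  sorted-nonnesting⇒standard SM (sortBy-sorted M) u (All-resp-↭ (↭-sym (sortBy-↭ M)) o)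
    (λ e f e∈ f∈ → nn e f (∈-resp-↭ (sortBy-↭ M) e∈) (∈-resp-↭ (sortBy-↭ M) f∈)) , pSM
  where
  SM : List Edge
  SM = sortBy proj₁ M
  pSM : endpoints SM ↭ interval 1 K
  pSM = ↭-trans (endpoints-↭ (sortBy-↭ M)) p
  u : Unique (endpoints SM)
  u = unique-resp-↭ (↭-sym pSM) (increasing⇒unique (interval-increasing 1 K))

rights-complement⁺ : ∀ {K M v} → StandardOn K M → v ∈ rights M → v ∈ interval 1 K × ¬ (v ∈ lefts M)
rights-complement⁺ {K} {M} s@((_ , _ , o) , p) v∈ with ∈-rights⁻ {M} v∈
... | a , av∈ = ∈-resp-↭ p (∈-endpointsʳ av∈) ,
                λ v∈' → not-left-and-right (standardOn-unique s) o av∈ (proj₂ (∈-lefts⁻ {M} v∈'))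

rights-complement⁻ : ∀ {K M v} → StandardOn K M → v ∈ interval 1 K → ¬ (v ∈ lefts M) → v ∈ rights M
rights-complement⁻ {K} {M} (_ , p) v∈ v∉ with ∈-endpoints⁻ {M} (∈-resp-↭ (↭-sym p) v∈)
... | inj₁ (b , vb∈) = ⊥-elim (v∉ (∈-lefts⁺ vb∈))
... | inj₂ (a , av∈) = ∈-rights⁺ av∈

zip-lefts-rights : ∀ (M M' : List Edge) → lefts M ≡ lefts M' → rights M ≡ rights M' → M ≡ M'
zip-lefts-rights [] [] _ _ = refl
zip-lefts-rights ((a , b) ∷ M) ((c , d) ∷ M') p q with ∷-injective p | ∷-injective q
... | refl , p' | refl , q' = cong ((a , b) ∷_) (zip-lefts-rights M M' p' q')

-- A standard matching on [K] is determined by its set of left endpoints: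
-- both its lefts and (by complement) its rights are determined as sets,
-- and increasing lists are determined by their elements.
standard-determined-by-lefts : ∀ {K M M'} → StandardOn K M → StandardOn K M' →
  (∀ v → v ∈ lefts M → v ∈ lefts M') → (∀ v → v ∈ lefts M' → v ∈ lefts M) → M ≡ M'
standard-determined-by-lefts {K} {M} {M'} s@((lM , rM , _) , _) s'@((lM' , rM' , _) , _) ⊆ ⊇ =
  zip-lefts-rights M M' (increasing-extensional _ _ lM lM' ⊆ ⊇)
    (increasing-extensional _ _ rM rM'
      (λ v v∈ → let (v∈K , v∉) = rights-complement⁺ s v∈ in rights-complement⁻ s' v∈K (λ z → v∉ (⊇ v z)))
      (λ v v∈ → let (v∈K , v∉) = rights-complement⁺ s' v∈ in rights-complement⁻ s v∈K (λ z → v∉ (⊆ v z))))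

AllPairs-∈-cases : ∀ {A : Set} {R : A → A → Set} {xs x y} → AllPairs R xs → x ∈ xs → y ∈ xs →
  x ≡ y ⊎ R x y ⊎ R y x
AllPairs-∈-cases _ (here refl) (here refl) = inj₁ refl
AllPairs-∈-cases (h ∷ _) (here refl) (there q) = inj₂ (inj₁ (All.lookup h q))
AllPairs-∈-cases (h ∷ _) (there p) (here refl) = inj₂ (inj₂ (All.lookup h p))
AllPairs-∈-cases (_ ∷ t) (there p) (there q) = AllPairs-∈-cases t p q

-- two edges of a standard matching are comparable in both coordinates at once
standard⇒nonnesting : ∀ {M} → Standard M → NoNestings M
standard⇒nonnesting (il , ir , _) e f e∈ f∈ (a<c , _ , d<b)
  with AllPairs-∈-cases (AllPairs.zip (AllPairs.map⁻ il , AllPairs.map⁻ ir)) e∈ f∈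
... | inj₁ refl = <-irrefl refl a<c
... | inj₂ (inj₁ (_ , b<d)) = <-asym b<d d<b
... | inj₂ (inj₂ (c<a , _)) = <-asym c<a a<c

-- The b-sequence of a
-- north-free path is valid and ends in 1 (north-free-path below).
ValidB : ℕ → List ℕ → Set
ValidB x [] = ⊥
ValidB x (b ∷ []) = b ≡ x
ValidB x (b ∷ b' ∷ B) = (1 ≤ b × b ≤ suc b') × ValidB x (b' ∷ B)

validB-bound : ∀ b B → ValidB 1 (b ∷ B) → b ≤ suc (length B)
validB-bound b [] refl = ≤-refl
validB-bound b (b' ∷ B) ((_ , b≤) , v) = ≤-trans b≤ (s≤s (validB-bound b' B v))

-- The right endpoints produced by ψ: after a right endpoint o created by the
-- term p, the term b creates the right endpoint o + 1 + (b + 1 - p).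
rightPositions : ℕ → ℕ → List ℕ → List ℕ
rightPositions o p [] = []
rightPositions o p (b ∷ B) = suc (o + (suc b ∸ p)) ∷ rightPositions (suc (o + (suc b ∸ p))) b B

rightPositions-> : ∀ o p B v → v ∈ rightPositions o p B → o < v
rightPositions-> o p (b ∷ B) v (here refl) = s≤s (m≤m+n o _)
rightPositions-> o p (b ∷ B) v (there q) = <-trans (s≤s (m≤m+n o _)) (rightPositions-> _ b B v q)

pick-after : ∀ (X : List ℕ) y Y → pick (suc (length X)) (X ++ y ∷ Y) ≡ (y , X ++ Y)
pick-after [] y Y = refl
pick-after (x ∷ X) y Y rewrite pick-after X y Y = refl

-- The state of ψ before a step: a block X of b pending vertices, all below r,
-- followed by the untouched interval [r, r + k).  The step matches the first
-- vertex of X with r (the b-th remaining vertex after it); the next block is the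
-- rest of X followed by the b' - (b - 1) vertices after r.
module PsiStep (x r k₀ b' : ℕ) (X' : List ℕ) (b'≥ : length X' ≤ b') (k₀≥ : b' ∸ length X' ≤ k₀) where

  t r⁺ : ℕ
  t = b' ∸ length X'
  r⁺ = suc (r + t)
  X⁺ : List ℕ
  X⁺ = X' ++ interval (suc r) t

  state-regroup : X' ++ interval (suc r) k₀ ≡ X⁺ ++ interval r⁺ (k₀ ∸ t)
  state-regroup = begin
    X' ++ interval (suc r) k₀
      ≡⟨ cong (λ z → X' ++ interval (suc r) z) (sym (m+[n∸m]≡n k₀≥)) ⟩
    X' ++ interval (suc r) (t + (k₀ ∸ t))                   ≡⟨ cong (X' ++_) (interval-++ (suc r) t (k₀ ∸ t)) ⟩
    X' ++ (interval (suc r) t ++ interval r⁺ (k₀ ∸ t))       ≡⟨ sym (++-assoc X' (interval (suc r) t) _) ⟩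
    X⁺ ++ interval r⁺ (k₀ ∸ t)                               ∎
    where open ≡-Reasoning

  length-X⁺ : length X⁺ ≡ b'
  length-X⁺ = trans (length-++ X') (trans (cong (λ z → length X' + z) (length-interval (suc r) t)) (m+[n∸m]≡n b'≥))

  X⁺-increasing : Increasing X' → All (_< r) X' → Increasing X⁺
  X⁺-increasing iX' X'<r = AllPairs.++⁺ iX' (interval-increasing (suc r) t)
    (All.map (λ v<r → All.tabulate (λ w∈ → <-trans v<r (proj₁ (∈-interval⁻ w∈)))) X'<r)

  X⁺-below : All (_< r) X' → All (_< r⁺) X⁺
  X⁺-below X'<r = All.++⁺ (All.map (λ v<r → <-trans v<r (s≤s (m≤m+n r t))) X'<r)
                          (All.tabulate (λ w∈ → proj₂ (∈-interval⁻ w∈)))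

  sizes-next : ∀ {total} → length X' + k₀ ≡ total → b' + (k₀ ∸ t) ≡ total
  sizes-next {total} sizes = begin
    b' + (k₀ ∸ t)                     ≡⟨ cong (_+ (k₀ ∸ t)) (sym (m+[n∸m]≡n b'≥)) ⟩
    (length X' + t) + (k₀ ∸ t)        ≡⟨ +-assoc (length X') t _ ⟩
    length X' + (t + (k₀ ∸ t))        ≡⟨ cong (λ z → length X' + z) (m+[n∸m]≡n k₀≥) ⟩
    length X' + k₀                    ≡⟨ sizes ⟩
    total                             ∎
    where open ≡-Reasoning

  state-above : All (x <_) X' → x < r → ∀ w → w ∈ X⁺ ++ interval r⁺ (k₀ ∸ t) → x < w
  state-above x<X' x<r w w∈ with ∈-++⁻ X⁺ w∈
  ... | inj₂ w∈I = <-trans x<r (<-≤-trans (s≤s (m≤m+n r t)) (proj₁ (∈-interval⁻ w∈I)))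
  ... | inj₁ w∈X⁺ with ∈-++⁻ X' w∈X⁺
  ...   | inj₁ w∈X' = All.lookup x<X' w∈X'
  ...   | inj₂ w∈I = <-≤-trans x<r (≤-trans (n≤1+n r) (proj₁ (∈-interval⁻ w∈I)))

next-block-fits : ∀ l k₀ b' m → l + k₀ ≡ 2 * suc m → b' ≤ suc m → b' ∸ l ≤ k₀
next-block-fits l k₀ b' m sizes b'≤ =
  ≤-trans (∸-monoˡ-≤ l (≤-trans b'≤ (m≤m+n (suc m) _)))
          (≤-reflexive (trans (cong (_∸ l) (sym sizes)) (m+n∸m≡n l k₀)))

PsiResult : ℕ → ℕ → List ℕ → List ℕ → Set
PsiResult r b B st = (rights (psiGo st (b ∷ B)) ≡ r ∷ rightPositions r b B) × Standard (psiGo st (b ∷ B))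
                     × (endpoints (psiGo st (b ∷ B)) ↭ st)

psi-run : ∀ B b X r k → ValidB 1 (b ∷ B) → length X ≡ b → Increasing X → All (_< r) X →
  b + k ≡ 2 * suc (length B) → PsiResult r b B (X ++ interval r k)
psi-run B b X r zero v refl _ _ e =
  ⊥-elim (m+1+n≰m (suc (length B)) (subst (_≤ suc (length B)) (trans (sym (+-identityʳ _)) e) (validB-bound _ B v)))
psi-run [] _ (x ∷ []) r (suc zero) _ refl _ (x<r ∷ []) _ =
  refl , (([] ∷ []) , ([] ∷ []) , (x<r ∷ [])) , ↭-refl
psi-run [] _ (x ∷ []) r (suc (suc k)) _ refl _ _ ()
psi-run [] _ [] r (suc k) () refl _ _ _
psi-run [] _ (x ∷ y ∷ X) r (suc k) () refl _ _ _
psi-run (b' ∷ B) _ [] r (suc k₀) ((() , _) , _) refl _ _ _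
psi-run (b' ∷ B) _ (x ∷ X') r (suc k₀) ((_ , b≤) , v) refl (x<X' ∷ iX') (x<r ∷ X'<r) e
  rewrite pick-after X' r (interval (suc r) k₀) =
  cong (r ∷_) rights-O' ,
  ((All.map⁺ (All.tabulate x<lefts) ∷ il') , (All.map⁺ (All.tabulate r<rights) ∷ ir') , (x<r ∷ o')) ,
  prep x (↭-trans (prep r ends-O') (↭-sym (shift r X' (interval (suc r) k₀))))
  where
  l m : ℕ
  l = length X'
  m = length B
  sizes : l + k₀ ≡ 2 * suc m
  sizes = suc-injective (suc-injective (trans (trans (cong suc (sym (+-suc l k₀))) e) (*-suc 2 (suc m))))
  open PsiStep x r k₀ b' X' (s≤s⁻¹ b≤) (next-block-fits l k₀ b' m sizes (validB-bound b' B v))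
  O' : List Edge
  O' = psiGo (X' ++ interval (suc r) k₀) (b' ∷ B)
  IH : PsiResult r⁺ b' B (X' ++ interval (suc r) k₀)
  IH = subst (PsiResult r⁺ b' B) (sym state-regroup)
         (psi-run B b' X⁺ r⁺ (k₀ ∸ t) v length-X⁺ (X⁺-increasing iX' X'<r) (X⁺-below X'<r) (sizes-next sizes))
  rights-O' : rights O' ≡ r⁺ ∷ rightPositions r⁺ b' B
  rights-O' = proj₁ IH
  il' : Increasing (lefts O')
  il' = proj₁ (proj₁ (proj₂ IH))
  ir' : Increasing (rights O')
  ir' = proj₁ (proj₂ (proj₁ (proj₂ IH)))
  o' : Oriented O'
  o' = proj₂ (proj₂ (proj₁ (proj₂ IH)))
  ends-O' : endpoints O' ↭ X' ++ interval (suc r) k₀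
  ends-O' = proj₂ (proj₂ IH)
  x<lefts : ∀ {f} → f ∈ O' → x < proj₁ f
  x<lefts {(a , _)} f∈ =
    state-above x<X' x<r a (subst (a ∈_) state-regroup (∈-resp-↭ ends-O' (∈-endpointsˡ f∈)))
  r<rights : ∀ {f} → f ∈ O' → r < proj₂ f
  r<rights {(_ , c)} f∈ with subst (c ∈_) rights-O' (∈-rights⁺ f∈)
  ... | here refl = s≤s (m≤m+n r t)
  ... | there c∈ = <-trans (s≤s (m≤m+n r t)) (rightPositions-> _ b' B c c∈)

vertices-split : ∀ n b → b ≤ 2 * n → range1 (2 * n) ≡ interval 1 b ++ interval (suc b) (2 * n ∸ b)
vertices-split n b b≤2n = trans (range1≡interval (2 * n))
  (trans (cong (interval 1) (sym (m+[n∸m]≡n b≤2n))) (interval-++ 1 b (2 * n ∸ b)))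

psi-standard : ∀ n b B → ValidB 1 (b ∷ B) → length (b ∷ B) ≡ n →
  StandardOn (2 * n) (psiGo (range1 (2 * n)) (b ∷ B))
  × rights (psiGo (range1 (2 * n)) (b ∷ B)) ≡ rightPositions 0 1 (b ∷ B)
psi-standard n b B v refl =
  (proj₁ (proj₂ result) , ↭-trans (proj₂ (proj₂ result)) (↭-reflexive (range1≡interval (2 * n)))) , proj₁ result
  where
  b≤2n : b ≤ 2 * n
  b≤2n = ≤-trans (validB-bound b B v) (m≤m+n n (n + 0))
  result : PsiResult (suc b) b B (range1 (2 * n))
  result = subst (PsiResult (suc b) b B) (sym (vertices-split n b b≤2n))
    (psi-run B b (interval 1 b) (suc b) (2 * n ∸ b) v (length-interval 1 b) (interval-increasing 1 b)
       (All.tabulate (λ w∈ → proj₂ (∈-interval⁻ w∈))) (m+[n∸m]≡n b≤2n))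

filterᵇ-accept : ∀ {A : Set} (p : A → Bool) x xs → p x ≡ true → filterᵇ p (x ∷ xs) ≡ x ∷ filterᵇ p xs
filterᵇ-accept p x xs px rewrite px = refl

filterᵇ-reject : ∀ {A : Set} (p : A → Bool) x xs → p x ≡ false → filterᵇ p (x ∷ xs) ≡ filterᵇ p xs
filterᵇ-reject p x xs px rewrite px = refl

count-map : ∀ {A : Set} (p : ℕ → Bool) (q : A → Bool) (g : A → ℕ) (xs : List A) →
  (∀ {w} → w ∈ xs → p (g w) ≡ q w) → length (filterᵇ p (map g xs)) ≡ length (filterᵇ q xs)
count-map p q g [] h = refl
count-map p q g (x ∷ xs) h with q x in qx
... | true rewrite filterᵇ-accept p (g x) (map g xs) (trans (h (here refl)) qx) =
  cong suc (count-map p q g xs (λ w∈ → h (there w∈)))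
... | false rewrite filterᵇ-reject p (g x) (map g xs) (trans (h (here refl)) qx) =
  count-map p q g xs (λ w∈ → h (there w∈))

count-below-interval₀ : ∀ v a k → v ≤ a → length (filterᵇ (_<ᵇ v) (interval a k)) ≡ 0
count-below-interval₀ v a zero _ = refl
count-below-interval₀ v a (suc k) v≤a rewrite filterᵇ-reject (_<ᵇ v) a (interval (suc a) k) (<ᵇ-false (≤⇒≯ v≤a)) =
  count-below-interval₀ v (suc a) k (≤-trans v≤a (n≤1+n a))

count-below-interval : ∀ v a k → a ≤ v → v ≤ a + k → length (filterᵇ (_<ᵇ v) (interval a k)) ≡ v ∸ a
count-below-interval v a zero a≤v v≤a =
  sym (trans (cong (v ∸_) (≤-antisym a≤v (subst (v ≤_) (+-identityʳ a) v≤a))) (n∸n≡0 v))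
count-below-interval v a (suc k) a≤v v≤a+k with a ≟ v
... | yes refl rewrite n∸n≡0 a = count-below-interval₀ a a (suc k) ≤-refl
... | no a≢v rewrite filterᵇ-accept (_<ᵇ v) a (interval (suc a) k) (<ᵇ-true (≤∧≢⇒< a≤v a≢v)) =
  trans (cong suc (count-below-interval v (suc a) k (≤∧≢⇒< a≤v a≢v) (subst (v ≤_) (+-suc a k) v≤a+k)))
        (sym (+-∸-assoc 1 (≤∧≢⇒< a≤v a≢v)))

orient-id : ∀ a b → a < b → orient (a , b) ≡ (a , b)
orient-id a b a<b rewrite <ᵇ-true a<b = refl

-- normalize replaces each vertex by its rank among all vertices present
rank : List Edge → ℕ → ℕ
rank A v = suc (length (filterᵇ (_<ᵇ v) (endpoints A)))

normalize-relabel : ∀ K (A M : List Edge) (g : ℕ → ℕ) → (∀ {v w} → 1 ≤ v → v < w → g v < g w) →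
  A ↭ map (mapEdge g) M → endpoints M ↭ interval 1 K → Oriented M → normalize A ↭ M
normalize-relabel K A M g g-mono A↭gM endsM o =
  ↭-trans (map⁺ renumber A↭gM) (↭-reflexive (trans (sym (map-∘ M)) (map-id-local (All.tabulate renumber-g))))
  where
  renumber : Edge → Edge
  renumber e = orient (mapEdge (rank A) e)
  positive : ∀ {v} → v ∈ interval 1 K → 1 ≤ v
  positive v∈ = proj₁ (∈-interval⁻ v∈)
  g-compare : ∀ {v w} → 1 ≤ v → 1 ≤ w → (g w <ᵇ g v) ≡ (w <ᵇ v)
  g-compare {v} {w} 1≤v 1≤w with <-cmp w v
  ... | tri< w<v _ _ = trans (<ᵇ-true (g-mono 1≤w w<v)) (sym (<ᵇ-true w<v))
  ... | tri≈ _ refl _ = trans (<ᵇ-false {g v} (<-irrefl refl)) (sym (<ᵇ-false {v} (<-irrefl refl)))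
  ... | tri> _ _ v<w = trans (<ᵇ-false (<⇒≯ (g-mono 1≤v v<w))) (sym (<ᵇ-false (<⇒≯ v<w)))
  endsA : endpoints A ↭ map g (interval 1 K)
  endsA = ↭-trans (endpoints-↭ A↭gM) (↭-trans (↭-reflexive (endpoints-map g M)) (map⁺ g endsM))
  rank-g : ∀ {v} → v ∈ interval 1 K → rank A (g v) ≡ v
  rank-g {v} v∈ = begin
    suc (length (filterᵇ (_<ᵇ g v) (endpoints A)))          ≡⟨ cong suc (↭-length (filter-↭ _ endsA)) ⟩
    suc (length (filterᵇ (_<ᵇ g v) (map g (interval 1 K)))) ≡⟨ cong suc (count-map _ _ g (interval 1 K)
                                                                  (λ w∈ → g-compare (positive v∈) (positive w∈))) ⟩
    suc (length (filterᵇ (_<ᵇ v) (interval 1 K)))           ≡⟨ cong suc (count-below-interval v 1 K (positive v∈)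
                                                                  (<⇒≤ (proj₂ (∈-interval⁻ v∈)))) ⟩
    suc (v ∸ 1)                                             ≡⟨ m+[n∸m]≡n (positive v∈) ⟩
    v                                                       ∎
    where open ≡-Reasoning
  renumber-g : ∀ {e} → e ∈ M → renumber (mapEdge g e) ≡ e
  renumber-g {(a , b)} e∈ =
    trans (cong orient (cong₂ _,_ (rank-g (∈-resp-↭ endsM (∈-endpointsˡ e∈)))
                                  (rank-g (∈-resp-↭ endsM (∈-endpointsʳ e∈)))))
          (orient-id a b (All.lookup o e∈))

unren-below : ∀ r w → w + 1 < r → unren r w ≡ w + 1
unren-below r w w+1<r rewrite <ᵇ-true w+1<r = refl

unren-above : ∀ r w → ¬ (w + 1 < r) → unren r w ≡ w + 2
unren-above r w w+1≮r rewrite <ᵇ-false w+1≮r = refl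

ren-unren : ∀ r w → ren r (unren r w) ≡ w
ren-unren r w with w + 1 <? r
... | yes w+1<r rewrite <ᵇ-true w+1<r | <ᵇ-true w+1<r = m+n∸n≡m w 1
... | no w+1≮r rewrite <ᵇ-false w+1≮r | <ᵇ-false {w + 2} {r} (λ q → w+1≮r (<-trans (+-monoʳ-< w (n<1+n 1)) q)) =
  m+n∸n≡m w 2

unren-mono : ∀ r {w w'} → w < w' → unren r w < unren r w'
unren-mono r {w} {w'} w<w' with w + 1 <? r | w' + 1 <? r
... | yes p | yes q rewrite unren-below r w p | unren-below r w' q = +-monoˡ-< 1 w<w'
... | yes p | no q rewrite unren-below r w p | unren-above r w' q = +-mono-< w<w' (n<1+n 1)
... | no p | yes q = ⊥-elim (p (<-trans (+-monoˡ-< 1 w<w') q))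
... | no p | no q rewrite unren-above r w p | unren-above r w' q = +-monoˡ-< 2 w<w'

unren-reflects : ∀ r {w w'} → unren r w < unren r w' → w < w'
unren-reflects r {w} {w'} uw<uw' with <-cmp w w'
... | tri< w<w' _ _ = w<w'
... | tri≈ _ refl _ = ⊥-elim (<-irrefl refl uw<uw')
... | tri> _ _ w'<w = ⊥-elim (<-asym uw<uw' (unren-mono r w'<w))

unren-interval : ∀ j N' → j ≤ N' →
  map (unren (suc (suc j))) (interval 1 N') ≡ interval 2 j ++ interval (3 + j) (N' ∸ j)
unren-interval j N' j≤N' = begin
  map u (interval 1 N')                                      ≡⟨ cong (map u) (trans (cong (interval 1) (sym (m+[n∸m]≡n j≤N')))
                                                                                   (interval-++ 1 j (N' ∸ j))) ⟩
  map u (interval 1 j ++ interval (suc j) (N' ∸ j))          ≡⟨ map-++ u (interval 1 j) _ ⟩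
  map u (interval 1 j) ++ map u (interval (suc j) (N' ∸ j))  ≡⟨ cong₂ _++_ low high ⟩
  interval 2 j ++ interval (3 + j) (N' ∸ j)                  ∎
  where
  open ≡-Reasoning
  u : ℕ → ℕ
  u = unren (suc (suc j))
  low : map u (interval 1 j) ≡ interval 2 j
  low = map-interval-shift u 1 j 1 (λ w _ w<1+j → unren-below _ w (subst (_< suc (suc j)) (+-comm 1 w) (s≤s w<1+j)))
  high : map u (interval (suc j) (N' ∸ j)) ≡ interval (3 + j) (N' ∸ j)
  high = trans (map-interval-shift u (suc j) (N' ∸ j) 2
                 (λ w 1+j≤w _ → unren-above _ w
                   (λ w+1<j+2 → <⇒≱ w+1<j+2 (subst (suc (suc j) ≤_) (+-comm 1 w) (s≤s 1+j≤w)))))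
               (cong (λ z → interval z (N' ∸ j)) (+-comm (suc j) 2))

vertices-without : ∀ r K → 2 ≤ r → r ≤ suc (suc K) → interval 1 (suc (suc K)) ↭ 1 ∷ r ∷ map (unren r) (interval 1 K)
vertices-without (suc zero) K (s≤s ()) _
vertices-without (suc (suc j)) K _ r≤K+2 rewrite unren-interval j K (s≤s⁻¹ (s≤s⁻¹ r≤K+2)) =
  prep 1 (↭-trans (↭-reflexive split) (shift (suc (suc j)) (interval 2 j) _))
  where
  split : interval 2 (suc K) ≡ interval 2 j ++ suc (suc j) ∷ interval (3 + j) (K ∸ j)
  split = trans (cong (interval 2) (sym (trans (+-suc j (K ∸ j)) (cong suc (m+[n∸m]≡n (s≤s⁻¹ (s≤s⁻¹ r≤K+2)))))))
                (interval-++ 2 j (suc (K ∸ j)))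

standard-reflect : ∀ (f : ℕ → ℕ) → (∀ {x y} → f x < f y → x < y) → ∀ M → Standard (map (mapEdge f) M) → Standard M
standard-reflect f f-reflects M (il , ir , o) =
  AllPairs.map f-reflects (AllPairs.map⁻ (subst Increasing (lefts-map f M) il)) ,
  AllPairs.map f-reflects (AllPairs.map⁻ (subst Increasing (rights-map f M) ir)) ,
  All.map f-reflects (All.map⁻ o)

delete-first : ∀ K r R → StandardOn (suc (suc K)) ((1 , r) ∷ R) → 2 ≤ r → r ≤ suc (suc K) →
  StandardOn K (map (mapEdge (ren r)) R) × map (mapEdge (unren r)) (map (mapEdge (ren r)) R) ≡ R
delete-first K r R ((il , ir , o) , endsR₀) 2≤r r≤K+2 =
  (standard-reflect (unren r) (unren-reflects r) R' (subst Standard (sym restore) (AllPairs.tail il , AllPairs.tail ir , All.tail o)) ,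
   endsR') ,
  restore
  where
  R' : List Edge
  R' = map (mapEdge (ren r)) R
  endsR : endpoints R ↭ map (unren r) (interval 1 K)
  endsR = drop-∷ (drop-∷ (↭-trans endsR₀ (vertices-without r K 2≤r r≤K+2)))
  unren-ren : ∀ {v} → v ∈ endpoints R → unren r (ren r v) ≡ v
  unren-ren v∈ with ∈-map⁻ (unren r) (∈-resp-↭ endsR v∈)
  ... | w , _ , refl = cong (unren r) (ren-unren r w)
  restore : map (mapEdge (unren r)) R' ≡ R
  restore = trans (sym (map-∘ R)) (map-id-local (All.tabulate (λ {e} e∈ → restore-edge e e∈)))
    where
    restore-edge : ∀ e → e ∈ R → mapEdge (unren r) (mapEdge (ren r) e) ≡ e
    restore-edge (a , b) e∈ = cong₂ _,_ (unren-ren (∈-endpointsˡ e∈)) (unren-ren (∈-endpointsʳ e∈))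
  endsR' : endpoints R' ↭ interval 1 K
  endsR' = ↭-trans (↭-reflexive (endpoints-map (ren r) R))
    (↭-trans (map⁺ (ren r) endsR)
      (↭-reflexive (trans (sym (map-∘ (interval 1 K))) (map-id-local (All.tabulate (λ {w} _ → ren-unren r w))))))

-- In the crossed case φ places vertex v of the original matching at
-- position crossedPosition r v of the doubled picture: 1 stays first, the
-- left ends 2, …, r - 2 move to the next left end (vertex 2 is deleted), r - 1
-- moves to the new vertex just before r, and vertices from r on stay put.
crossedPosition : ℕ → ℕ → ℕ
crossedPosition r v =
  if v <ᵇ 2 then 2 * v else (if suc v <ᵇ r then 2 * suc v else (if suc v ≡ᵇ r then 2 * r ∸ 1 else 2 * v))

data Zone (r v : ℕ) : Set where
  before : suc v < r → crossedPosition r v ≡ 2 * suc v → Zone r v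
  last : suc v ≡ r → crossedPosition r v ≡ suc (2 * v) → Zone r v
  after : r ≤ v → crossedPosition r v ≡ 2 * v → Zone r v

zone : ∀ r v → 2 ≤ v → Zone r v
zone r v 2≤v with suc v <? r | suc v ≟ r
... | yes v+1<r | _ = before v+1<r unfold
  where
  unfold : crossedPosition r v ≡ 2 * suc v
  unfold rewrite <ᵇ-false {v} {2} (≤⇒≯ 2≤v) | <ᵇ-true v+1<r = refl
... | no v+1≮r | yes v+1≡r = last v+1≡r unfold
  where
  unfold : crossedPosition r v ≡ suc (2 * v)
  unfold rewrite <ᵇ-false {v} {2} (≤⇒≯ 2≤v) | <ᵇ-false v+1≮r | ≡ᵇ-true v+1≡r | sym v+1≡r =
    cong (_∸ 1) (*-suc 2 v)
... | no v+1≮r | no v+1≢r = after (s≤s⁻¹ (≤∧≢⇒< (≮⇒≥ v+1≮r) (λ e → v+1≢r (sym e)))) unfold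
  where
  unfold : crossedPosition r v ≡ 2 * v
  unfold rewrite <ᵇ-false {v} {2} (≤⇒≯ 2≤v) | <ᵇ-false v+1≮r | ≡ᵇ-false v+1≢r = refl

crossedPosition-after : ∀ r v → 2 ≤ v → r ≤ v → crossedPosition r v ≡ 2 * v
crossedPosition-after r v 2≤v r≤v with zone r v 2≤v
... | before v+1<r _ = ⊥-elim (<⇒≱ v+1<r (≤-trans r≤v (n≤1+n v)))
... | last v+1≡r _ = ⊥-elim (<⇒≱ (≤-reflexive v+1≡r) r≤v)
... | after _ eq = eq

crossedPosition-before : ∀ r v → 2 ≤ v → suc v < r → crossedPosition r v ≡ 2 * suc v
crossedPosition-before r v 2≤v v+1<r with zone r v 2≤v
... | before _ eq = eq
... | last v+1≡r _ = ⊥-elim (<-irrefl v+1≡r v+1<r)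
... | after r≤v _ = ⊥-elim (<⇒≱ v+1<r (≤-trans r≤v (n≤1+n v)))

crossedPosition-last : ∀ r v → 2 ≤ v → suc v ≡ r → crossedPosition r v ≡ suc (2 * v)
crossedPosition-last r v 2≤v v+1≡r with zone r v 2≤v
... | before v+1<r _ = ⊥-elim (<-irrefl v+1≡r v+1<r)
... | last _ eq = eq
... | after r≤v _ = ⊥-elim (<⇒≱ (≤-reflexive v+1≡r) r≤v)

crossedPosition-≤ : ∀ r v → 1 ≤ v → crossedPosition r v ≤ 2 * suc v
crossedPosition-≤ r (suc zero) _ = s≤s (s≤s z≤n)
crossedPosition-≤ r v@(suc (suc _)) _ with zone r v (s≤s (s≤s z≤n))
... | before _ eq = ≤-reflexive eq
... | last _ eq = ≤-trans (≤-reflexive eq) (≤-trans (n≤1+n _) (≤-reflexive (sym (*-suc 2 v))))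
... | after _ eq = ≤-trans (≤-reflexive eq) (*-monoʳ-≤ 2 (n≤1+n v))

crossedPosition-<-after : ∀ r {v w} → 1 ≤ v → v < w → r ≤ w → crossedPosition r v < 2 * w
crossedPosition-<-after r {suc zero} _ 1<w _ = *-monoʳ-< 2 1<w
crossedPosition-<-after r {v@(suc (suc _))} {w} _ v<w r≤w with zone r v (s≤s (s≤s z≤n))
... | before v+1<r eq = ≤-<-trans (≤-reflexive eq) (*-monoʳ-< 2 (<-≤-trans v+1<r r≤w))
... | last v+1≡r eq = <-≤-trans (≤-<-trans (≤-reflexive eq) (≤-reflexive (sym (*-suc 2 v))))
                                (*-monoʳ-≤ 2 (≤-trans (≤-reflexive v+1≡r) r≤w))
... | after _ eq = ≤-<-trans (≤-reflexive eq) (*-monoʳ-< 2 v<w)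

crossedPosition-mono : ∀ r {v w} → 1 ≤ v → v < w → crossedPosition r v < crossedPosition r w
crossedPosition-mono r {v} {w} 1≤v v<w with zone r w (≤-trans (s≤s 1≤v) v<w)
... | before _ eq = <-≤-trans (≤-<-trans (crossedPosition-≤ r v 1≤v) (*-monoʳ-< 2 (s≤s v<w))) (≤-reflexive (sym eq))
... | last _ eq = <-≤-trans (s≤s (≤-trans (crossedPosition-≤ r v 1≤v) (*-monoʳ-≤ 2 v<w))) (≤-reflexive (sym eq))
... | after r≤w eq = <-≤-trans (crossedPosition-<-after r 1≤v v<w r≤w) (≤-reflexive (sym eq))

chain-relabels : ∀ r s t F → 2 ≤ r → 2 ≤ s → r ≡ s + t → lefts F ≡ interval s t → All (λ e → r < proj₂ e) F →
  chain r F ≡ map (mapEdge (crossedPosition r)) F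
chain-relabels r s t [] _ _ _ _ _ = refl
chain-relabels r s zero (_ ∷ _) _ _ _ () _
chain-relabels r s (suc zero) ((l , x) ∷ []) 2≤r 2≤s r≡ lefts≡ (r<x ∷ []) with ∷-injective lefts≡
... | refl , _ = cong (_∷ []) (cong₂ _,_ new-vertex (sym (crossedPosition-after r x (≤-trans 2≤r (<⇒≤ r<x)) (<⇒≤ r<x))))
  where
  r≡l+1 : r ≡ suc l
  r≡l+1 = trans r≡ (+-comm l 1)
  new-vertex : 2 * r ∸ 1 ≡ crossedPosition r l
  new-vertex = trans (cong (λ z → 2 * z ∸ 1) r≡l+1)
                     (trans (cong (_∸ 1) (*-suc 2 l)) (sym (crossedPosition-last r l 2≤s (sym r≡l+1))))
chain-relabels r s (suc zero) (_ ∷ _ ∷ _) _ _ _ lefts≡ _ with ∷-injective lefts≡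
... | _ , ()
chain-relabels r s (suc (suc t)) (_ ∷ []) _ _ _ lefts≡ _ with ∷-injective lefts≡
... | _ , ()
chain-relabels r s (suc (suc t)) ((l , x) ∷ (l' , x') ∷ F) 2≤r 2≤s r≡ lefts≡ (r<x ∷ r<F) with ∷-injective lefts≡
... | refl , lefts≡' with ∷-injective lefts≡'
...   | refl , _ = cong₂ _∷_
        (cong₂ _,_ (sym (crossedPosition-before r l 2≤s l+1<r))
                   (sym (crossedPosition-after r x (≤-trans 2≤r (<⇒≤ r<x)) (<⇒≤ r<x))))
        (chain-relabels r (suc l) (suc t) ((suc l , x') ∷ F) 2≤r (≤-trans 2≤s (n≤1+n l))
                        (trans r≡ (+-suc l (suc t))) lefts≡' r<F)
  where
  l+1<r : suc l < r
  l+1<r = subst (suc l <_) (sym r≡) (subst (_< l + suc (suc t)) (+-comm l 1) (+-monoʳ-< l (s≤s (s≤s z≤n))))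

filterᵇ-partition : ∀ {A : Set} (p : A → Bool) xs → xs ↭ filterᵇ p xs ++ filterᵇ (λ e → not (p e)) xs
filterᵇ-partition p [] = ↭-refl
filterᵇ-partition p (x ∷ xs) with p x
... | true = prep x (filterᵇ-partition p xs)
... | false = ↭-trans (prep x (filterᵇ-partition p xs)) (↭-sym (shift x (filterᵇ p xs) _))

-- The edges of R crossing (1 , r) are those with left endpoints 2, …, r - 1
-- (every vertex below r other than 1 is a left endpoint); all other edges lie
-- beyond r.  So φ's reconnection is the relabelling crossedPosition r of the
-- original edges, and normalizing gives back the matching.
module CrossedCase (K r : ℕ) (R : List Edge) (std : StandardOn K ((1 , r) ∷ R)) (2≤r : 2 ≤ r) (r≤K : r ≤ K) where

  private
    il : Increasing (lefts ((1 , r) ∷ R))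
    il = proj₁ (proj₁ std)
    ir : Increasing (rights ((1 , r) ∷ R))
    ir = proj₁ (proj₂ (proj₁ std))
    o : Oriented ((1 , r) ∷ R)
    o = proj₂ (proj₂ (proj₁ std))
    ends : endpoints ((1 , r) ∷ R) ↭ interval 1 K
    ends = proj₂ std

  crosses : Edge → Bool
  crosses = crossesE1 r

  left-> : ∀ {a b} → (a , b) ∈ R → 1 < a
  left-> ab∈ = All.lookup (AllPairs.head il) (∈-lefts⁺ ab∈)

  right-> : ∀ {a b} → (a , b) ∈ R → r < b
  right-> ab∈ = All.lookup (AllPairs.head ir) (∈-rights⁺ ab∈)

  left-≢ : ∀ {a b} → (a , b) ∈ R → ¬ r ≡ a
  left-≢ ab∈ = All.lookup (AllPairs.head (AllPairs.tail (standardOn-unique std))) (∈-endpointsˡ ab∈)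

  crosses-iff : ∀ {a b} → (a , b) ∈ R → crosses (a , b) ≡ (a <ᵇ r)
  crosses-iff {a} ab∈ rewrite <ᵇ-true (left-> ab∈) | <ᵇ-true (right-> ab∈) = ∧-identityʳ (a <ᵇ r)

  Crossing Beyond : List Edge
  Crossing = filterᵇ crosses R
  Beyond = filterᵇ (λ e → not (crosses e)) R

  crossing-sorted : StrictlySorted Crossing
  crossing-sorted = AllPairs.filter⁺ _ (AllPairs.map⁻ (AllPairs.tail il))

  crossing-lefts : lefts Crossing ≡ interval 2 (r ∸ 2)
  crossing-lefts = increasing-extensional _ _ (AllPairs.map⁺ crossing-sorted) (interval-increasing 2 (r ∸ 2)) ⊆ ⊇
    where
    2+[r-2] : 2 + (r ∸ 2) ≡ r
    2+[r-2] = m+[n∸m]≡n 2≤r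
    ⊆ : ∀ v → v ∈ lefts Crossing → v ∈ interval 2 (r ∸ 2)
    ⊆ v v∈ with ∈-filter⁻ _ (proj₂ (∈-lefts⁻ {Crossing} v∈))
    ... | vb∈ , crosses-vb = ∈-interval⁺ (left-> vb∈)
                               (subst (v <_) (sym 2+[r-2]) (<ᵇ-true⁻ (trans (sym (crosses-iff vb∈)) (T⇒≡true crosses-vb))))
    ⊇ : ∀ v → v ∈ interval 2 (r ∸ 2) → v ∈ lefts Crossing
    ⊇ v v∈ with ∈-interval⁻ v∈
    ... | 2≤v , v<2+[r-2] with subst (v <_) 2+[r-2] v<2+[r-2]
    ...   | v<r with ∈-resp-↭ (↭-sym ends)
                       (∈-interval⁺ {1} {K} (≤-trans (n≤1+n 1) 2≤v) (≤-trans v<r (≤-trans r≤K (n≤1+n K))))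
    ...     | here refl = ⊥-elim (<-irrefl refl 2≤v)
    ...     | there (here refl) = ⊥-elim (<-irrefl refl v<r)
    ...     | there (there v∈R) with ∈-endpoints⁻ {R} v∈R
    ...       | inj₁ (b , vb∈) = ∈-lefts⁺ (∈-filter⁺ _ vb∈ (≡true⇒T (trans (crosses-iff vb∈) (<ᵇ-true v<r))))
    ...       | inj₂ (a , av∈) = ⊥-elim (<-asym v<r (right-> av∈))

  crossing-rights : All (λ e → r < proj₂ e) Crossing
  crossing-rights = All.tabulate (λ {e} e∈ → beyond-right e (proj₁ (∈-filter⁻ _ e∈)))
    where
    beyond-right : ∀ e → e ∈ R → r < proj₂ e
    beyond-right (a , b) e∈ = right-> e∈

  beyond : ∀ {a b} → (a , b) ∈ Beyond → r < a × r < b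
  beyond {a} ab∈ with ∈-filter⁻ _ ab∈
  ... | ab∈R , not-crosses =
    ≤∧≢⇒< (≮⇒≥ (<ᵇ-false⁻ (trans (sym (crosses-iff ab∈R)) (not-true not-crosses)))) (left-≢ ab∈R) , right-> ab∈R
    where
    not-true : ∀ {x} → T (not x) → x ≡ false
    not-true {false} _ = refl

  beyond-relabels : map dbl Beyond ≡ map (mapEdge (crossedPosition r)) Beyond
  beyond-relabels = map-cong-local (All.tabulate (λ {e} e∈ → doubled e e∈))
    where
    doubled : ∀ e → e ∈ Beyond → dbl e ≡ mapEdge (crossedPosition r) e
    doubled (a , b) e∈ with beyond e∈
    ... | r<a , r<b = cong₂ _,_ (sym (crossedPosition-after r a (≤-trans 2≤r (<⇒≤ r<a)) (<⇒≤ r<a)))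
                                (sym (crossedPosition-after r b (≤-trans 2≤r (<⇒≤ r<b)) (<⇒≤ r<b)))

  crossed-case : ∀ N₂ → N₂ ↭ R →
    normalize (dbl (1 , r) ∷ map dbl (filterᵇ (λ e → not (crosses e)) N₂) ++ chain r (sortBy proj₁ (filterᵇ crosses N₂)))
    ↭ (1 , r) ∷ R
  crossed-case N₂ N₂↭R =
    ↭-trans (normalize-relabel K _ Reordered (crossedPosition r) (crossedPosition-mono r) relabelled
               (↭-trans (endpoints-↭ reordered) ends) (All-resp-↭ (↭-sym reordered) o))
            reordered
    where
    Reordered : List Edge
    Reordered = (1 , r) ∷ Beyond ++ Crossing
    reordered : Reordered ↭ (1 , r) ∷ R
    reordered = prep (1 , r) (↭-trans (++-comm Beyond Crossing) (↭-sym (filterᵇ-partition crosses R)))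
    sorted-crossing : sortBy proj₁ (filterᵇ crosses N₂) ≡ Crossing
    sorted-crossing = sorted-unique _ Crossing (sortBy-sorted (filterᵇ crosses N₂)) crossing-sorted
                        (↭-trans (sortBy-↭ (filterᵇ crosses N₂)) (filter-↭ _ N₂↭R))
    relabelled : dbl (1 , r) ∷ map dbl (filterᵇ (λ e → not (crosses e)) N₂) ++ chain r (sortBy proj₁ (filterᵇ crosses N₂))
                 ↭ map (mapEdge (crossedPosition r)) Reordered
    relabelled = ↭-trans (prep (dbl (1 , r)) (++⁺ʳ _ (map⁺ dbl (filter-↭ _ N₂↭R))))
      (↭-reflexive (cong₂ _∷_ (cong (2 ,_) (sym (crossedPosition-after r r 2≤r ≤-refl)))
        (trans (cong₂ _++_ beyond-relabels
                  (trans (cong (chain r) sorted-crossing)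
                         (chain-relabels r 2 (r ∸ 2) Crossing 2≤r ≤-refl (sym (m+[n∸m]≡n 2≤r))
                                         crossing-lefts crossing-rights)))
               (sym (map-++ (mapEdge (crossedPosition r)) Beyond Crossing)))))

-- φ first orients and sorts its input, which does nothing to a standard matching
orient-sort-standard : ∀ M → Standard M → sortBy proj₁ (map orient M) ≡ M
orient-sort-standard M (il , _ , o) =
  trans (cong (sortBy proj₁) (map-id-local (All.tabulate (λ {e} e∈ → oriented e e∈)))) (sortBy-id M (AllPairs.map⁻ il))
  where
  oriented : ∀ e → e ∈ M → orient e ≡ e
  oriented (a , b) e∈ = orient-id a b (All.lookup o e∈)

-- the renumbered result of φ's recursive call on the matching without its first edge (1 , r)
Rest : ℕ → ℕ → List Edge → List Edge
Rest k r R = map (mapEdge (unren r)) (phiF k (map (mapEdge (ren r)) R))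

phi-single : ∀ k e → Standard (e ∷ []) → phiF (suc k) (e ∷ []) ≡ e ∷ []
phi-single k e std rewrite orient-sort-standard (e ∷ []) std = refl

-- The first edge of a standard matching on [K] is (1 , r) with 2 ≤ r ≤ K:
-- every vertex is at least the first left endpoint.
first-edge : ∀ K l r R → StandardOn K ((l , r) ∷ R) → l ≡ 1 × 2 ≤ r × r ≤ K
first-edge K l r R ((il , ir , o) , ends) =
  l≡1 , ≤-trans (s≤s 1≤l) l<r , s≤s⁻¹ (proj₂ (∈-interval⁻ (∈-resp-↭ ends (there (here refl)))))
  where
  1≤l : 1 ≤ l
  1≤l = proj₁ (∈-interval⁻ (∈-resp-↭ ends (here refl)))
  l<r : l < r
  l<r = All.lookup o (here refl)
  l-least : ∀ v → v ∈ endpoints ((l , r) ∷ R) → l ≤ v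
  l-least v (here refl) = ≤-refl
  l-least v (there (here refl)) = <⇒≤ l<r
  l-least v (there (there v∈)) with ∈-endpoints⁻ {R} v∈
  ... | inj₁ (b , vb∈) = <⇒≤ (All.lookup (AllPairs.head il) (∈-lefts⁺ vb∈))
  ... | inj₂ (a , av∈) = <⇒≤ (<-trans l<r (All.lookup (AllPairs.head ir) (∈-rights⁺ av∈)))
  1≤K : 1 ≤ K
  1≤K = s≤s⁻¹ (≤-trans (s≤s 1≤l) (proj₂ (∈-interval⁻ (∈-resp-↭ ends (here refl)))))
  l≡1 : l ≡ 1
  l≡1 = ≤-antisym (l-least 1 (∈-resp-↭ (↭-sym ends) (∈-interval⁺ ≤-refl (s≤s 1≤K)))) 1≤l

-- One step of φ on a standard matching M = (1 , r) ∷ (c , q) ∷ rest, given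
-- that the recursive call fixed the rest: the first two edges are aligned or
-- crossed (never nested, as q > r), and in both cases M is reproduced.
module PhiStep (k K r c q : ℕ) (rest : List Edge) (std : StandardOn (suc (suc K)) ((1 , r) ∷ (c , q) ∷ rest)) where

  M R : List Edge
  M = (1 , r) ∷ (c , q) ∷ rest
  R = (c , q) ∷ rest

  r<q : (r <ᵇ q) ≡ true
  r<q = <ᵇ-true (All.lookup (AllPairs.head (proj₁ (proj₂ (proj₁ std)))) (here refl))

  unfold-aligned : (r <ᵇ c) ≡ true → phiF (suc k) M ≡ (1 , r) ∷ Rest k r R
  unfold-aligned r<c rewrite orient-sort-standard M (proj₁ std) | r<c = refl

  unfold-crossed : (r <ᵇ c) ≡ false →
    phiF (suc k) M ≡ normalize (dbl (1 , r) ∷ map dbl (filterᵇ (λ e → not (crossesE1 r e)) (Rest k r R))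
                                ++ chain r (sortBy proj₁ (filterᵇ (crossesE1 r) (Rest k r R))))
  unfold-crossed r≮c rewrite orient-sort-standard M (proj₁ std) | r≮c | r<q = refl

  phi-step : 2 ≤ r → r ≤ suc (suc K) → Rest k r R ↭ R → phiF (suc k) M ↭ M
  phi-step 2≤r r≤K+2 rest-fixed with r <ᵇ c in r?c
  ... | true = ↭-trans (↭-reflexive (unfold-aligned r?c)) (prep (1 , r) rest-fixed)
  ... | false = ↭-trans (↭-reflexive (unfold-crossed r?c))
                        (CrossedCase.crossed-case (suc (suc K)) r R std 2≤r r≤K+2 (Rest k r R) rest-fixed)

phi-fixes-standard : ∀ k K M → length M ≡ k → StandardOn K M → phiF k M ↭ M
phi-fixes-standard zero K [] refl _ = ↭-refl
phi-fixes-standard (suc k) K (e ∷ []) _ std = ↭-reflexive (phi-single k e (proj₁ std))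
phi-fixes-standard (suc k) K ((l , r) ∷ (c , q) ∷ rest) len std with first-edge K l r ((c , q) ∷ rest) std
phi-fixes-standard (suc k) zero ((l , r) ∷ _ ∷ _) _ _ | _ , 2≤r , r≤0 = ⊥-elim (<⇒≱ (≤-trans (s≤s z≤n) 2≤r) r≤0)
phi-fixes-standard (suc k) (suc zero) ((l , r) ∷ _ ∷ _) _ _ | _ , 2≤r , r≤1 = ⊥-elim (<⇒≱ 2≤r r≤1)
phi-fixes-standard (suc k) (suc (suc K)) ((.1 , r) ∷ (c , q) ∷ rest) len std | refl , 2≤r , r≤K+2 =
  PhiStep.phi-step k K r c q rest std 2≤r r≤K+2
    (↭-trans (map⁺ (mapEdge (unren r)) (phi-fixes-standard k K _ length-rest (proj₁ deleted))) (↭-reflexive (proj₂ deleted)))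
  where
  deleted : StandardOn K (map (mapEdge (ren r)) ((c , q) ∷ rest))
            × map (mapEdge (unren r)) (map (mapEdge (ren r)) ((c , q) ∷ rest)) ≡ (c , q) ∷ rest
  deleted = delete-first K r ((c , q) ∷ rest) std 2≤r r≤K+2
  length-rest : length (map (mapEdge (ren r)) ((c , q) ∷ rest)) ≡ k
  length-rest = trans (length-map _ ((c , q) ∷ rest)) (suc-injective len)

vertical-down : ∀ y y' → y' ℤ.≤ y → vert y y' ≡ replicate ∣ y ℤ.- y' ∣ S
vertical-down y y' y'≤y with y' ℤ.≤? y
... | yes _ = refl
... | no y'≰y = ⊥-elim (y'≰y y'≤y)

vertical-up : ∀ y y' → ¬ (y' ℤ.≤ y) → N ∈ replicate ∣ y' ℤ.- y ∣ N
vertical-up y y' y'≰y with ∣ y' ℤ.- y ∣ in d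
... | suc _ = here refl
... | zero = ⊥-elim (y'≰y (ℤ.≤-reflexive (begin
    y'                  ≡⟨ sub-add y y' ⟩
    (y' ℤ.- y) ℤ.+ y    ≡⟨ cong (ℤ._+ y) (ℤ.∣i∣≡0⇒i≡0 {y' ℤ.- y} d) ⟩
    + 0 ℤ.+ y           ≡⟨ ℤ.+-identityˡ y ⟩
    y                   ∎)))
  where
  open ≡-Reasoning
  sub-add : ∀ y y' → y' ≡ (y' ℤ.- y) ℤ.+ y
  sub-add = solve-∀

-- The d-value of an east step at height y with j east steps before it is
-- d = y + j + 1; inside the wedge (y ≥ -j) it is positive.
dValue : ℕ → ℤ → ℕ
dValue j y = ∣ y ℤ.+ + suc j ∣

dValue-positive : ∀ j y → ℤ.- (+ j) ℤ.≤ y → 1 ≤ dValue j y × + dValue j y ≡ y ℤ.+ + suc j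
dValue-positive j y -j≤y = positive (y ℤ.+ + suc j) 1≤d
  where
  neg-add : ∀ J → ℤ.- J ℤ.+ (1ℤ ℤ.+ J) ≡ 1ℤ
  neg-add = solve-∀
  1≤d : + 1 ℤ.≤ y ℤ.+ + suc j
  1≤d = subst (ℤ._≤ y ℤ.+ + suc j) (neg-add (+ j)) (ℤ.+-monoˡ-≤ (+ suc j) -j≤y)
  positive : ∀ u → + 1 ℤ.≤ u → 1 ≤ ∣ u ∣ × + ∣ u ∣ ≡ u
  positive (+ m) (ℤ.+≤+ 1≤m) = 1≤m , refl

drop-length : ∀ j y y' → y' ℤ.≤ y → ℤ.- (+ j) ℤ.≤ y → ℤ.- (+ suc j) ℤ.≤ y' →
  (∣ y ℤ.- y' ∣ ≡ suc (dValue j y) ∸ dValue (suc j) y') × dValue (suc j) y' ≤ suc (dValue j y)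
drop-length j y y' y'≤y -j≤y -j-1≤y' = cong ∣_∣ drop , d'≤d+1
  where
  d d' : ℕ
  d = dValue j y
  d' = dValue (suc j) y'
  +d : + d ≡ y ℤ.+ + suc j
  +d = proj₂ (dValue-positive j y -j≤y)
  +d' : + d' ≡ y' ℤ.+ + suc (suc j)
  +d' = proj₂ (dValue-positive (suc j) y' -j-1≤y')
  shift-suc : ∀ y J → y ℤ.+ (1ℤ ℤ.+ J) ≡ 1ℤ ℤ.+ (y ℤ.+ J)
  shift-suc = solve-∀
  difference : ∀ y y' J → (1ℤ ℤ.+ (y ℤ.+ J)) ℤ.- (y' ℤ.+ (1ℤ ℤ.+ J)) ≡ y ℤ.- y'
  difference = solve-∀
  d'≤d+1 : d' ≤ suc d
  d'≤d+1 = ℤ.drop‿+≤+ (subst₂ ℤ._≤_ (sym +d') (trans (shift-suc y (+ suc j)) (cong (λ z → 1ℤ ℤ.+ z) (sym +d)))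
                                 (ℤ.+-monoˡ-≤ (+ suc (suc j)) y'≤y))
  drop : y ℤ.- y' ≡ + (suc d ∸ d')
  drop = begin
    y ℤ.- y'                                                         ≡⟨ sym (difference y y' (+ suc j)) ⟩
    (1ℤ ℤ.+ (y ℤ.+ + suc j)) ℤ.- (y' ℤ.+ (1ℤ ℤ.+ + suc j))
      ≡⟨ cong₂ (λ a b → (1ℤ ℤ.+ a) ℤ.- b) (sym +d) (sym +d') ⟩
    + suc d ℤ.- + d'                                                 ≡⟨ ℤ.m-n≡m⊖n (suc d) d' ⟩
    suc d ℤ.⊖ d'                                                     ≡⟨ ℤ.⊖-≥ d'≤d+1 ⟩
    + (suc d ∸ d')                                                   ∎
    where open ≡-Reasoning

dValues : ℕ → List ℤ → List ℕ
dValues j [] = []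
dValues j (y ∷ ys) = dValue j y ∷ dValues (suc j) ys

length-dValues : ∀ j ys → length (dValues j ys) ≡ length ys
length-dValues j [] = refl
length-dValues j (y ∷ ys) = cong suc (length-dValues (suc j) ys)

InWedge : ℕ → List ℤ → Set
InWedge j [] = ⊤
InWedge j (y ∷ ys) = ℤ.- (+ j) ℤ.≤ y × InWedge (suc j) ys

ValidD : List ℕ → Set
ValidD [] = ⊤
ValidD (d ∷ []) = 1 ≤ d
ValidD (d ∷ d' ∷ D) = (1 ≤ d × d' ≤ suc d) × ValidD (d' ∷ D)

validD-head : ∀ d D → ValidD (d ∷ D) → 1 ≤ d
validD-head d [] 1≤d = 1≤d
validD-head d (d' ∷ D) ((1≤d , _) , _) = 1≤d

-- the first d-value of the rest, 1 for the final drop to -n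
nextD : List ℕ → ℕ
nextD [] = 1
nextD (d ∷ _) = d

pathWord : List ℕ → List Step
pathWord [] = []
pathWord (d ∷ D) = E ∷ replicate (suc d ∸ nextD D) S ++ pathWord D

north-free-word : ∀ j y ys n → InWedge j (y ∷ ys) → NoNorth (stepsFrom (y ∷ ys) (ℤ.- (+ n))) →
  j + length (y ∷ ys) ≡ n →
  stepsFrom (y ∷ ys) (ℤ.- (+ n)) ≡ pathWord (dValues j (y ∷ ys)) × ValidD (dValues j (y ∷ ys))
north-free-word j y [] n (-j≤y , _) _ j+1≡n =
  cong (E ∷_) (trans (vertical-down y _ -n≤y) (trans (cong (λ z → replicate z S) final-drop) (sym (++-identityʳ _)))) ,
  proj₁ (dValue-positive j y -j≤y)
  where
  n≡j+1 : n ≡ suc j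
  n≡j+1 = trans (sym j+1≡n) (+-comm j 1)
  -n≤y : ℤ.- (+ n) ℤ.≤ y
  -n≤y = ℤ.≤-trans (subst (λ z → ℤ.- (+ z) ℤ.≤ ℤ.- (+ j)) (sym n≡j+1) (ℤ.neg-mono-≤ (ℤ.+≤+ (n≤1+n j))))
                   -j≤y
  final-drop : ∣ y ℤ.- ℤ.- (+ n) ∣ ≡ dValue j y
  final-drop = cong ∣_∣ (cong (λ z → y ℤ.+ z) (trans (ℤ.neg-involutive (+ n)) (cong +_ n≡j+1)))
north-free-word j y (y' ∷ ys) n (-j≤y , inWedge) noNorth j+k≡n with y' ℤ.≤? y
... | no y'≰y = ⊥-elim (noNorth (there (∈-++⁺ˡ (vertical-up y y' y'≰y))))
... | yes y'≤y with north-free-word (suc j) y' ys n inWedge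
                      (λ N∈ → noNorth (∈-++⁺ʳ (E ∷ replicate ∣ y ℤ.- y' ∣ S) N∈))
                      (trans (sym (+-suc j (length (y' ∷ ys)))) j+k≡n)
...   | rest≡ , validRest =
  cong (E ∷_) (cong₂ _++_ (cong (λ z → replicate z S) (proj₁ drop)) rest≡) ,
  ((proj₁ (dValue-positive j y -j≤y) , proj₂ drop) , validRest)
  where
  drop : (∣ y ℤ.- y' ∣ ≡ suc (dValue j y) ∸ dValue (suc j) y') × dValue (suc j) y' ≤ suc (dValue j y)
  drop = drop-length j y y' y'≤y -j≤y (proj₁ inWedge)

validB-snoc : ∀ x y B → ValidB x B → 1 ≤ x → x ≤ suc y → ValidB y (B ++ y ∷ [])
validB-snoc x y (b ∷ []) refl 1≤x x≤y+1 = (1≤x , x≤y+1) , refl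
validB-snoc x y (b ∷ b' ∷ B) (b≤ , v) 1≤x x≤y+1 = b≤ , validB-snoc x y (b' ∷ B) v 1≤x x≤y+1

validD-reverse : ∀ d D → ValidD (d ∷ D) → ValidB d (reverse (d ∷ D))
validD-reverse d [] _ = refl
validD-reverse d (d' ∷ D) ((_ , d'≤d+1) , v) =
  subst (ValidB d) (sym (unfold-reverse d (d' ∷ D)))
    (validB-snoc d' d (reverse (d' ∷ D)) (validD-reverse d' D v) (validD-head d' D v) d'≤d+1)

revWord : ℕ → List ℕ → List Step
revWord p [] = []
revWord p (b ∷ B) = replicate (suc b ∸ p) S ++ E ∷ revWord b B

lastOr : ℕ → List ℕ → ℕ
lastOr p [] = p
lastOr p (b ∷ B) = lastOr b B

revWord-snoc : ∀ p B x → revWord p (B ++ x ∷ []) ≡ revWord p B ++ replicate (suc x ∸ lastOr p B) S ++ E ∷ []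
revWord-snoc p [] x = refl
revWord-snoc p (b ∷ B) x = trans (cong (λ z → replicate (suc b ∸ p) S ++ E ∷ z) (revWord-snoc b B x))
  (sym (++-assoc (replicate (suc b ∸ p) S) (E ∷ revWord b B) _))

lastOr-snoc : ∀ p B x → lastOr p (B ++ x ∷ []) ≡ x
lastOr-snoc p [] x = refl
lastOr-snoc p (b ∷ B) x = lastOr-snoc b B x

lastOr-reverse : ∀ D → lastOr 1 (reverse D) ≡ nextD D
lastOr-reverse [] = refl
lastOr-reverse (d ∷ D) = trans (cong (lastOr 1) (unfold-reverse d D)) (lastOr-snoc 1 (reverse D) d)

reverse-replicate : ∀ n (x : Step) → reverse (replicate n x) ≡ replicate n x
reverse-replicate zero x = refl
reverse-replicate (suc n) x =
  trans (unfold-reverse x (replicate n x)) (trans (cong (_++ x ∷ []) (reverse-replicate n x)) (snoc n))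
  where
  snoc : ∀ n → replicate n x ++ x ∷ [] ≡ x ∷ replicate n x
  snoc zero = refl
  snoc (suc n) = cong (x ∷_) (snoc n)

reverse-pathWord : ∀ D → reverse (pathWord D) ≡ revWord 1 (reverse D)
reverse-pathWord [] = refl
reverse-pathWord (d ∷ D) = begin
  reverse (E ∷ Ss ++ pathWord D)                                     ≡⟨ unfold-reverse E (Ss ++ pathWord D) ⟩
  reverse (Ss ++ pathWord D) ++ E ∷ []                               ≡⟨ cong (_++ E ∷ []) (reverse-++ Ss (pathWord D)) ⟩
  (reverse (pathWord D) ++ reverse Ss) ++ E ∷ []
    ≡⟨ cong (λ z → (z ++ reverse Ss) ++ E ∷ []) (reverse-pathWord D) ⟩
  (revWord 1 (reverse D) ++ reverse Ss) ++ E ∷ []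
    ≡⟨ cong (λ z → (revWord 1 (reverse D) ++ z) ++ E ∷ []) (reverse-replicate _ S) ⟩
  (revWord 1 (reverse D) ++ Ss) ++ E ∷ []
    ≡⟨ ++-assoc (revWord 1 (reverse D)) Ss (E ∷ []) ⟩
  revWord 1 (reverse D) ++ Ss ++ E ∷ []
    ≡⟨ cong (λ z → revWord 1 (reverse D) ++ replicate (suc d ∸ z) S ++ E ∷ []) (sym (lastOr-reverse D)) ⟩
  revWord 1 (reverse D) ++ replicate (suc d ∸ lastOr 1 (reverse D)) S ++ E ∷ []
    ≡⟨ sym (revWord-snoc 1 (reverse D) d) ⟩
  revWord 1 (reverse D ++ d ∷ [])                                    ≡⟨ cong (revWord 1) (sym (unfold-reverse d D)) ⟩
  revWord 1 (reverse (d ∷ D))                                        ∎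
  where
  open ≡-Reasoning
  Ss : List Step
  Ss = replicate (suc d ∸ nextD D) S

length-block : ∀ s W → length (replicate s S ++ E ∷ W) ≡ s + suc (length W)
length-block s W = trans (length-++ (replicate s S)) (cong (_+ suc (length W)) (length-replicate s))

length-revWord : ∀ p b B → p ≤ suc b → ValidB 1 (b ∷ B) → length (revWord p (b ∷ B)) + p ≡ 2 * suc (length B) + 1
length-revWord p b [] p≤b+1 refl = begin
  length (replicate (2 ∸ p) S ++ E ∷ []) + p   ≡⟨ cong (_+ p) (length-block (2 ∸ p) []) ⟩
  (2 ∸ p) + 1 + p                             ≡⟨ move-p (2 ∸ p) p ⟩
  ((2 ∸ p) + p) + 1                           ≡⟨ cong (_+ 1) (m∸n+n≡m p≤b+1) ⟩
  2 * 1 + 1                                   ∎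
  where
  open ≡-Reasoning
  move-p : ∀ s p → s + 1 + p ≡ (s + p) + 1
  move-p = ℕ-Solver.solve-∀
length-revWord p b (b' ∷ B) p≤b+1 ((_ , b≤b'+1) , v) = begin
  length (replicate s S ++ E ∷ W) + p    ≡⟨ cong (_+ p) (length-block s W) ⟩
  s + suc X + p                          ≡⟨ move-p s X p ⟩
  (s + p) + suc X                        ≡⟨ cong (_+ suc X) (m∸n+n≡m p≤b+1) ⟩
  suc b + suc X                          ≡⟨ regroup b X ⟩
  2 + (X + b)                            ≡⟨ cong (λ z → 2 + z) (length-revWord b b' B b≤b'+1 v) ⟩
  2 + (2 * suc (length B) + 1)           ≡⟨ double (length B) ⟩
  2 * suc (suc (length B)) + 1           ∎
  where
  open ≡-Reasoning
  s : ℕ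
  s = suc b ∸ p
  W : List Step
  W = revWord b (b' ∷ B)
  X : ℕ
  X = length W
  move-p : ∀ s X p → s + suc X + p ≡ (s + p) + suc X
  move-p = ℕ-Solver.solve-∀
  regroup : ∀ b X → suc b + suc X ≡ 2 + (X + b)
  regroup = ℕ-Solver.solve-∀
  double : ∀ m → 2 + (2 * suc m + 1) ≡ 2 * suc (suc m) + 1
  double = ℕ-Solver.solve-∀

nth-cons : ∀ {A : Set} (x : A) xs k → 1 ≤ k → nth (x ∷ xs) (suc k) ≡ nth xs k
nth-cons x xs (suc k) _ = refl

nth-++ʳ : ∀ {A : Set} (xs ys : List A) k → 1 ≤ k → nth (xs ++ ys) (length xs + k) ≡ nth ys k
nth-++ʳ [] ys k _ = refl
nth-++ʳ (x ∷ xs) ys k 1≤k = trans (nth-cons x (xs ++ ys) (length xs + k) (≤-trans 1≤k (m≤n+m k _))) (nth-++ʳ xs ys k 1≤k)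

nth-++ˡ : ∀ {A : Set} (xs ys : List A) k → 1 ≤ k → k ≤ length xs → nth (xs ++ ys) k ≡ nth xs k
nth-++ˡ (x ∷ xs) ys (suc zero) _ _ = refl
nth-++ˡ (x ∷ xs) ys (suc (suc k)) _ k≤ = nth-++ˡ xs ys (suc k) (s≤s z≤n) (s≤s⁻¹ k≤)

nth-replicate : ∀ {A : Set} n (x : A) k → 1 ≤ k → k ≤ n → nth (replicate n x) k ≡ just x
nth-replicate (suc n) x (suc zero) _ _ = refl
nth-replicate (suc n) x (suc (suc k)) _ k≤n = nth-replicate n x (suc k) (s≤s z≤n) (s≤s⁻¹ k≤n)

nth-reverse : ∀ {A : Set} (w : List A) i → 1 ≤ i → i ≤ length w → nth (reverse w) (length w + 1 ∸ i) ≡ nth w i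
nth-reverse (x ∷ w) (suc zero) _ _ = begin
  nth (reverse (x ∷ w)) (length w + 1)                   ≡⟨ cong (λ z → nth z (length w + 1)) (unfold-reverse x w) ⟩
  nth (reverse w ++ x ∷ []) (length w + 1)
    ≡⟨ cong (λ z → nth (reverse w ++ x ∷ []) (z + 1)) (sym (length-reverse w)) ⟩
  nth (reverse w ++ x ∷ []) (length (reverse w) + 1)     ≡⟨ nth-++ʳ (reverse w) (x ∷ []) 1 ≤-refl ⟩
  just x                                                 ∎
  where open ≡-Reasoning
nth-reverse (x ∷ w) (suc (suc i)) _ i+2≤ = begin
  nth (reverse (x ∷ w)) (length w + 1 ∸ suc i)
    ≡⟨ cong (λ z → nth z (length w + 1 ∸ suc i)) (unfold-reverse x w) ⟩
  nth (reverse w ++ x ∷ []) (length w + 1 ∸ suc i)       ≡⟨ nth-++ˡ (reverse w) (x ∷ []) _ pos-≥1 pos-≤ ⟩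
  nth (reverse w) (length w + 1 ∸ suc i)                 ≡⟨ nth-reverse w (suc i) (s≤s z≤n) (s≤s⁻¹ i+2≤) ⟩
  nth w (suc i)                                          ∎
  where
  open ≡-Reasoning
  pos≡ : length w + 1 ∸ suc i ≡ length w ∸ i
  pos≡ = cong (_∸ suc i) (+-comm (length w) 1)
  pos-≥1 : 1 ≤ length w + 1 ∸ suc i
  pos-≥1 = subst (1 ≤_) (sym pos≡) (m<n⇒0<n∸m (s≤s⁻¹ i+2≤))
  pos-≤ : length w + 1 ∸ suc i ≤ length (reverse w)
  pos-≤ = subst₂ _≤_ (sym pos≡) (sym (length-reverse w)) (m∸n≤m (length w) i)

module Block (s : ℕ) (W : List Step) where

  south : ∀ i → 1 ≤ i → i ≤ s → nth (replicate s S ++ E ∷ W) i ≡ just S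
  south i 1≤i i≤s = trans (nth-++ˡ (replicate s S) _ i 1≤i (subst (i ≤_) (sym (length-replicate s)) i≤s))
                          (nth-replicate s S i 1≤i i≤s)

  east : nth (replicate s S ++ E ∷ W) (suc s) ≡ just E
  east = trans (cong (nth (replicate s S ++ E ∷ W)) (trans (+-comm 1 s) (cong (_+ 1) (sym (length-replicate s)))))
               (nth-++ʳ (replicate s S) (E ∷ W) 1 ≤-refl)

  later : ∀ i → suc s < i → nth (replicate s S ++ E ∷ W) i ≡ nth W (i ∸ suc s)
  later i s+1<i = trans (cong (nth (replicate s S ++ E ∷ W)) i≡)
                        (trans (nth-++ʳ (replicate s S) (E ∷ W) (suc (i ∸ suc s)) (s≤s z≤n))
                               (nth-cons E W (i ∸ suc s) (m<n⇒0<n∸m s+1<i)))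
    where
    i≡ : i ≡ length (replicate s S) + suc (i ∸ suc s)
    i≡ = trans (sym (m+[n∸m]≡n (<⇒≤ s+1<i)))
               (trans (sym (+-suc s (i ∸ suc s))) (cong (_+ suc (i ∸ suc s)) (sym (length-replicate s))))

EastIff : List Step → ℕ → Set → Set
EastIff w i X = (nth w i ≡ just E × X) ⊎ (nth w i ≡ just S × ¬ X)

shifted-position : ∀ o s i → suc s < i → o + i ≡ suc (o + s) + (i ∸ suc s)
shifted-position o s i s+1<i =
  trans (cong (λ z → o + z) (sym (m+[n∸m]≡n (<⇒≤ s+1<i)))) (trans (+-suc o (s + _)) (cong suc (sym (+-assoc o s _))))

module _ (o p b : ℕ) (B : List ℕ) where
  private
    s o' : ℕ
    s = suc b ∸ p
    o' = suc (o + s)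

  past-first-block : ∀ i → suc s < i →
    EastIff (revWord b B) (i ∸ suc s) ((o' + (i ∸ suc s)) ∈ rightPositions o' b B) →
    EastIff (revWord p (b ∷ B)) i ((o + i) ∈ rightPositions o p (b ∷ B))
  past-first-block i s+1<i (inj₁ (east , right)) =
    inj₁ (trans (Block.later s (revWord b B) i s+1<i) east ,
          there (subst (_∈ rightPositions o' b B) (sym (shifted-position o s i s+1<i)) right))
  past-first-block i s+1<i (inj₂ (south , not-right)) =
    inj₂ (trans (Block.later s (revWord b B) i s+1<i) south , not-right')
    where
    not-right' : ¬ ((o + i) ∈ rightPositions o p (b ∷ B))
    not-right' (here eq) = <-irrefl (sym eq) (subst (o' <_) (sym (shifted-position o s i s+1<i)) (m<m+n _ (m<n⇒0<n∸m s+1<i)))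
    not-right' (there ∈rest) = not-right (subst (_∈ rightPositions o' b B) (shifted-position o s i s+1<i) ∈rest)

revWord-letter : ∀ o p B i → 1 ≤ i → i ≤ length (revWord p B) → EastIff (revWord p B) i ((o + i) ∈ rightPositions o p B)
revWord-letter o p [] i 1≤i i≤0 = ⊥-elim (<⇒≱ 1≤i i≤0)
revWord-letter o p (b ∷ B) i 1≤i i≤ with <-cmp i (suc (suc b ∸ p))
... | tri< i<s+1 _ _ = inj₂ (Block.south s (revWord b B) i 1≤i (s≤s⁻¹ i<s+1) , not-right)
  where
  s : ℕ
  s = suc b ∸ p
  o+i<o' : o + i < suc (o + s)
  o+i<o' = s≤s (+-monoʳ-≤ o (s≤s⁻¹ i<s+1))
  not-right : ¬ ((o + i) ∈ rightPositions o p (b ∷ B))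
  not-right (here eq) = <-irrefl eq o+i<o'
  not-right (there ∈rest) = <-asym o+i<o' (rightPositions-> _ b B _ ∈rest)
... | tri≈ _ refl _ = inj₁ (Block.east (suc b ∸ p) (revWord b B) , here (+-suc o (suc b ∸ p)))
... | tri> _ _ s+1<i =
  past-first-block o p b B i s+1<i (revWord-letter (suc (o + s)) b B (i ∸ suc s) (m<n⇒0<n∸m s+1<i) k≤)
  where
  s : ℕ
  s = suc b ∸ p
  k≤ : i ∸ suc s ≤ length (revWord b B)
  k≤ = ≤-trans (∸-monoˡ-≤ (suc s) (subst (i ≤_) (trans (length-block s (revWord b B)) (+-suc s _)) i≤))
               (≤-reflexive (m+n∸m≡n (suc s) (length (revWord b B))))

LeftEndsAreSouth : ℕ → List Step → List Edge → Set
LeftEndsAreSouth n w M = ∀ i → 1 ≤ i → i ≤ 2 * n →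
  (IsLeftEndpoint M i → nth w (2 * n + 1 ∸ i) ≡ just S) × (nth w (2 * n + 1 ∸ i) ≡ just S → IsLeftEndpoint M i)

-- All properties in the theorem only depend on the set of edges.

isMatching-↭ : ∀ {n M M'} → M ↭ M' → IsMatching n M → IsMatching n M'
isMatching-↭ M↭M' (o , ends) = All-resp-↭ M↭M' o , ↭-trans (endpoints-↭ (↭-sym M↭M')) ends

noNestings-↭ : ∀ {M M'} → M ↭ M' → NoNestings M → NoNestings M'
noNestings-↭ M↭M' nn e f e∈ f∈ = nn e f (∈-resp-↭ (↭-sym M↭M') e∈) (∈-resp-↭ (↭-sym M↭M') f∈)

leftEndsAreSouth-↭ : ∀ {n w M M'} → M ↭ M' → LeftEndsAreSouth n w M → LeftEndsAreSouth n w M'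
leftEndsAreSouth-↭ M↭M' south i 1≤i i≤2n =
  (λ (b , ib∈) → proj₁ (south i 1≤i i≤2n) (b , ∈-resp-↭ (↭-sym M↭M') ib∈)) ,
  (λ isS → let (b , ib∈) = proj₂ (south i 1≤i i≤2n) isS in b , ∈-resp-↭ M↭M' ib∈)

sameMatching-↭ : ∀ {M G G'} → G ↭ G' → SameMatching M G → SameMatching M G'
sameMatching-↭ G↭G' same a b = (λ ab∈ → ∈-resp-↭ G↭G' (proj₁ (same a b) ab∈)) ,
                               (λ ab∈ → proj₂ (same a b) (∈-resp-↭ (↭-sym G↭G') ab∈))

SameLeftEnds : ℕ → List Edge → List Edge → Set
SameLeftEnds K M G = ∀ i → 1 ≤ i → i ≤ K → (IsLeftEndpoint M i → IsLeftEndpoint G i) × (IsLeftEndpoint G i → IsLeftEndpoint M i)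

-- Uniqueness: a non-nesting matching on [K] whose left endpoints are those of
-- a standard matching G has the same edges as G (sorting it gives G).
nonnesting-unique : ∀ K M G → StandardOn K G → Oriented M → endpoints M ↭ interval 1 K → NoNestings M →
  SameLeftEnds K M G → SameMatching M G
nonnesting-unique K M G stdG o ends nn sameLefts a b =
  (λ ab∈ → subst ((a , b) ∈_) sorted≡G (∈-resp-↭ (↭-sym (sortBy-↭ M)) ab∈)) ,
  (λ ab∈ → ∈-resp-↭ (sortBy-↭ M) (subst ((a , b) ∈_) (sym sorted≡G) ab∈))
  where
  stdM : StandardOn K (sortBy proj₁ M)
  stdM = sort-nonnesting K M o ends nn
  in-range : ∀ {X v} → StandardOn K X → v ∈ lefts X → 1 ≤ v × v ≤ K
  in-range {X} (_ , endsX) v∈ =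
    let (_ , vb∈) = ∈-lefts⁻ {X} v∈
        (1≤v , v<K+1) = ∈-interval⁻ (∈-resp-↭ endsX (∈-endpointsˡ vb∈))
    in 1≤v , s≤s⁻¹ v<K+1
  ⊆ : ∀ v → v ∈ lefts (sortBy proj₁ M) → v ∈ lefts G
  ⊆ v v∈ with in-range stdM v∈ | ∈-lefts⁻ {sortBy proj₁ M} v∈
  ... | 1≤v , v≤K | c , vc∈ = ∈-lefts⁺ (proj₂ (proj₁ (sameLefts v 1≤v v≤K) (c , ∈-resp-↭ (sortBy-↭ M) vc∈)))
  ⊇ : ∀ v → v ∈ lefts G → v ∈ lefts (sortBy proj₁ M)
  ⊇ v v∈ with in-range stdG v∈ | ∈-lefts⁻ {G} v∈
  ... | 1≤v , v≤K | c , vc∈ =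
    ∈-lefts⁺ (∈-resp-↭ (↭-sym (sortBy-↭ M)) (proj₂ (proj₂ (sameLefts v 1≤v v≤K) (c , vc∈))))
  sorted≡G : sortBy proj₁ M ≡ G
  sorted≡G = standard-determined-by-lefts stdM stdG ⊆ ⊇

module ValidSequence (n b : ℕ) (B' : List ℕ) (w : List Step) (valid : ValidB 1 (b ∷ B'))
                     (length≡ : length (b ∷ B') ≡ n) (w≡ : w ≡ reverse (revWord 1 (b ∷ B'))) where

  B : List ℕ
  B = b ∷ B'
  G : List Edge
  G = psiGo (range1 (2 * n)) B

  stdG : StandardOn (2 * n) G
  stdG = proj₁ (psi-standard n b B' valid length≡)

  rightsG : rights G ≡ rightPositions 0 1 B
  rightsG = proj₂ (psi-standard n b B' valid length≡)

  phi-fixes-G : φ G ↭ G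
  phi-fixes-G = phi-fixes-standard (length G) (2 * n) G refl stdG

  length-word : length (revWord 1 B) ≡ 2 * n
  length-word = +-cancelʳ-≡ 1 _ _ (trans (length-revWord 1 b B' (s≤s z≤n) valid) (cong (λ z → 2 * z + 1) length≡))

  step≡letter : ∀ i → 1 ≤ i → i ≤ 2 * n → nth w (2 * n + 1 ∸ i) ≡ nth (revWord 1 B) i
  step≡letter i 1≤i i≤2n = begin
    nth w (2 * n + 1 ∸ i)                                         ≡⟨ cong (λ z → nth z (2 * n + 1 ∸ i)) w≡ ⟩
    nth (reverse (revWord 1 B)) (2 * n + 1 ∸ i)
      ≡⟨ cong (λ z → nth (reverse (revWord 1 B)) (z + 1 ∸ i)) (sym length-word) ⟩
    nth (reverse (revWord 1 B)) (length (revWord 1 B) + 1 ∸ i)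
      ≡⟨ nth-reverse (revWord 1 B) i 1≤i (subst (i ≤_) (sym length-word) i≤2n) ⟩
    nth (revWord 1 B) i                                           ∎
    where open ≡-Reasoning

  -- i is a left endpoint of ψ(B) exactly when it is not a right endpoint,
  -- i.e. when letter i of revWord 1 B is south
  psi-left-ends : LeftEndsAreSouth n w G
  psi-left-ends i 1≤i i≤2n with revWord-letter 0 1 B i 1≤i (subst (i ≤_) (sym length-word) i≤2n)
  ... | inj₁ (east , right) =
        (λ (c , ic∈) → ⊥-elim (proj₂ (rights-complement⁺ stdG (subst (i ∈_) (sym rightsG) right)) (∈-lefts⁺ ic∈))) ,
        (λ south → ⊥-elim (E≢S (trans (sym east) (trans (sym (step≡letter i 1≤i i≤2n)) south))))
    where
    E≢S : ¬ (just E ≡ just S)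
    E≢S ()
  ... | inj₂ (south , not-right) =
        (λ _ → trans (step≡letter i 1≤i i≤2n) south) ,
        (λ _ → left-endpoint (∈-endpoints⁻ {G} (∈-resp-↭ (↭-sym (proj₂ stdG)) (∈-interval⁺ 1≤i (s≤s i≤2n)))))
    where
    left-endpoint : (∃ λ c → (i , c) ∈ G) ⊎ (∃ λ a → (a , i) ∈ G) → IsLeftEndpoint G i
    left-endpoint (inj₁ ic∈) = ic∈
    left-endpoint (inj₂ (a , ai∈)) = ⊥-elim (not-right (subst (i ∈_) rightsG (∈-rights⁺ ai∈)))

  vertices≡ : range1 (2 * n) ≡ interval 1 (2 * n)
  vertices≡ = range1≡interval (2 * n)

  G-matching : IsMatching n G
  G-matching = proj₂ (proj₂ (proj₁ stdG)) , ↭-trans (proj₂ stdG) (↭-reflexive (sym vertices≡))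

  G-unique : ∀ M → IsMatching n M → NoNestings M → LeftEndsAreSouth n w M → SameMatching M G
  G-unique M (o , ends) nn south =
    nonnesting-unique (2 * n) M G stdG o (↭-trans ends (↭-reflexive vertices≡)) nn same-lefts
    where
    same-lefts : SameLeftEnds (2 * n) M G
    same-lefts i 1≤i i≤2n = (λ l → proj₂ (psi-left-ends i 1≤i i≤2n) (proj₁ (south i 1≤i i≤2n) l)) ,
                            (λ l → proj₂ (south i 1≤i i≤2n) (proj₁ (psi-left-ends i 1≤i i≤2n) l))

  -- everything transfers from ψ(B) to φ(ψ(B)), which has the same edges
  theorem : IsMatching n (φ G) × NoNestings (φ G) × LeftEndsAreSouth n w (φ G)
            × (∀ M → IsMatching n M → NoNestings M → LeftEndsAreSouth n w M → SameMatching M (φ G))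
  theorem =
    isMatching-↭ {n} (↭-sym phi-fixes-G) G-matching ,
    noNestings-↭ (↭-sym phi-fixes-G) (standard⇒nonnesting (proj₁ stdG)) ,
    leftEndsAreSouth-↭ {n} {w} (↭-sym phi-fixes-G) psi-left-ends ,
    λ M M-matching nn south → sameMatching-↭ (↭-sym phi-fixes-G) (G-unique M M-matching nn south)

inWedge-from : ∀ {m} (v : Vec ℤ m) k → (∀ (i : Fin m) → ℤ.- (+ (k + toℕ i)) ℤ.≤ lookup v i) → InWedge k (toList v)
inWedge-from Vec.[] k _ = tt
inWedge-from (y Vec.∷ v) k above =
  subst (λ z → ℤ.- (+ z) ℤ.≤ y) (+-identityʳ k) (above Fin.zero) ,
  inWedge-from v (suc k) (λ i → subst (λ z → ℤ.- (+ z) ℤ.≤ lookup v i) (+-suc k (toℕ i)) (above (Fin.suc i)))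

tabulate-dValues : ∀ {m} (v : Vec ℤ m) k →
  toList (tabulate (λ j → ∣ lookup v j ℤ.+ + suc (k + toℕ j) ∣)) ≡ dValues k (toList v)
tabulate-dValues Vec.[] k = refl
tabulate-dValues (y Vec.∷ v) k = cong₂ _∷_ (cong (λ z → ∣ y ℤ.+ + suc z ∣) (+-identityʳ k))
  (trans (cong toList (Vec.tabulate-cong (λ j → cong (λ z → ∣ lookup v j ℤ.+ + suc z ∣) (+-suc k (toℕ j)))))
         (tabulate-dValues v (suc k)))

-- For a path in 𝒫_n without north steps, the b-sequence of ψ is a valid
-- sequence of length n ending in 1 (the first east step is at height 0),
-- and the step word is the reverse of its revWord.
north-free-path : ∀ n (a : Vec ℤ (suc n)) → InP (suc n) a → NoNorth (steps (suc n) a) →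
  ValidB 1 (bseq (suc n) a) × length (bseq (suc n) a) ≡ suc n × steps (suc n) a ≡ reverse (revWord 1 (bseq (suc n) a))
north-free-path n a@(y Vec.∷ a') inP noNorth =
  subst (ValidB 1) (sym bseq≡) (subst (λ z → ValidB z (reverse D)) first-d≡1 (validD-reverse _ _ (proj₂ word))) ,
  trans (cong length bseq≡) (trans (length-reverse D) (trans (length-dValues 0 (toList a)) (cong suc (Vec.length-toList a')))) ,
  (begin
    steps (suc n) a                          ≡⟨ proj₁ word ⟩
    pathWord D                               ≡⟨ sym (reverse-involutive (pathWord D)) ⟩
    reverse (reverse (pathWord D))           ≡⟨ cong reverse (reverse-pathWord D) ⟩
    reverse (revWord 1 (reverse D))          ≡⟨ cong (λ z → reverse (revWord 1 z)) (sym bseq≡) ⟩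
    reverse (revWord 1 (bseq (suc n) a))     ∎)
  where
  open ≡-Reasoning
  D : List ℕ
  D = dValues 0 (toList a)
  word : steps (suc n) a ≡ pathWord D × ValidD D
  word = north-free-word 0 y (toList a') (suc n) (inWedge-from a 0 (λ i → proj₁ (inP i))) noNorth (cong suc (Vec.length-toList a'))
  bseq≡ : bseq (suc n) a ≡ reverse D
  bseq≡ = cong reverse (tabulate-dValues a 0)
  first-d≡1 : dValue 0 y ≡ 1
  first-d≡1 = cong (λ z → ∣ z ℤ.+ + 1 ∣) (ℤ.≤-antisym (proj₂ (inP Fin.zero)) (proj₁ (inP Fin.zero)))

proposition2 : (n : ℕ) → 1 ≤ n → (a : Vec ℤ n) → InP n a → NoNorth (steps n a) →
    IsMatching n (Φ n a) × NoNestings (Φ n a)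
    × (∀ i → 1 ≤ i → i ≤ 2 * n →
        (IsLeftEndpoint (Φ n a) i → nth (steps n a) (2 * n + 1 ∸ i) ≡ just S)
        × (nth (steps n a) (2 * n + 1 ∸ i) ≡ just S → IsLeftEndpoint (Φ n a) i))
    × (∀ (M : List Edge) → IsMatching n M → NoNestings M
        → (∀ i → 1 ≤ i → i ≤ 2 * n →
            (IsLeftEndpoint M i → nth (steps n a) (2 * n + 1 ∸ i) ≡ just S)
            × (nth (steps n a) (2 * n + 1 ∸ i) ≡ just S → IsLeftEndpoint M i))
        → SameMatching M (Φ n a))
proposition2 (suc n) _ a inP noNorth with north-free-path n a inP noNorth
... | valid , length≡ , steps≡ with bseq (suc n) a
...   | [] = ⊥-elim valid
...   | b ∷ B' = ValidSequence.theorem (suc n) b B' (steps (suc n) a) valid length≡ steps≡
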